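{- Let $Z=(U,\Omega,r)$ be a multimatroid and let $\prec$ be a total ordering of its skew classes. Then \[Q(Z;\mathbf x,t)= \sum_{T\in \mathrm{Comp}(Z,\prec)} \Bigg(\prod_{\omega \in \mathrm{inact}_{\prec}(T)} \mathbf x_{T_{\omega}}\Bigg) \Bigg(\prod_{\omega \in \mathrm{act}_{\prec}(T)} \Bigg(\sum_{e \in \omega-\{T_{\omega}\}} \mathbf x_e + t\,\mathbf x_{T_{\omega}}\Bigg)\Bigg).\]
   Context: A carrier is a pair $(U,\Omega)$, $U$ finite, $\Omega$ a partition of $U$ into non-empty skew classes; subtransversals meet each skew class at most once, transversals exactly once; skew pair: two distinct elements of a skew class. A multimatroid $Z=(U,\Omega,r)$ has a non-negative integer $r$ on subtransversals with (R1) on each transversal $r$ is a matroid rank function; (R2) for subtransversal $S$ and skew pair $\{x,y\}$ in a skew class disjoint from $S$, $r(S\cup\{x\})+r(S\cup\{y\})-2r(S)\ge1$. $n(S)=|S|-r(S)$; circuits are minimal subtransversals with $n>0$. $S_\omega$ is the element of $S\cap\omega$. A total order $\prec$ on skew classes induces an order on any subtransversal; $\min(C)$ is the least element. For a transversal $T$, a skew class $\omega$ is active with respect to $T$ if there is a circuit $C$ with $\min(C)\in\omega$ and $C-\omega\subseteq T$; otherwise inactive. $\mathrm{act}_\prec(T)$, $\mathrm{inact}_\prec(T)$ denote these sets. A transversal $S$ is $(Z,\prec)$-cocompatible if there is no circuit $C$ of $Z$ with $C-S=\{\min(C)\}$; $\mathrm{Comp}(Z,\prec)$ is the set of such transversals.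 $Q(Z;\mathbf x,t)=\sum_T t^{n(T)}\prod_{u\in T}\mathbf x_u$ over all transversals $T$, with indeterminates $\mathbf x_u$, $u\in U$. -}

module Defs where

open import Level using (0ℓ)
open import Data.Nat as ℕ using (ℕ; zero; suc; _<_; _≤_)
open import Data.Fin using (Fin)
open import Data.Fin.Subset using (Subset; _∈_; _∉_; _⊆_; _⊂_; _∪_; _∩_; ∣_∣; ⁅_⁆)
open import Data.Vec using (Vec; []; _∷_; lookup; tabulate)
open import Data.List using (List; []; _∷_; concatMap; map; filter)
open import Data.Product using (Σ; ∃; _×_; _,_)
open import Data.Bool using (Bool; true; false; if_then_else_)
open import Relation.Nullary using (¬_; Dec; does)
open import Relation.Binary using (Rel)
open import Relation.Binary.PropositionalEquality using (_≡_; _≢_)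
open import Data.Fin.Properties using (_≟_)
open import Algebra.Bundles using (CommutativeSemiring)

-- Carriers: U = Fin n, the skew classes are indexed by Fin m, and
-- cls u is the skew class containing u (cls surjective = classes non-empty).
-- Sets of elements are Subset n.

module _ {n m : ℕ} (cls : Fin n → Fin m) where

  IsSubtransversal : Subset n → Set
  IsSubtransversal S = ∀ x y → x ∈ S → y ∈ S → cls x ≡ cls y → x ≡ y

  IsTransversal : Subset n → Set
  IsTransversal T = IsSubtransversal T × (∀ ω → Σ (Fin n) λ u → cls u ≡ ω × u ∈ T)

IsMatroidRankOn : {n : ℕ} → Subset n → (Subset n → ℕ) → Set
IsMatroidRankOn T r =
  (∀ X → X ⊆ T → r X ≤ ∣ X ∣) ×
  (∀ X Y → X ⊆ Y → Y ⊆ T → r X ≤ r Y) ×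
  (∀ X Y → X ⊆ T → Y ⊆ T → r (X ∪ Y) ℕ.+ r (X ∩ Y) ≤ r X ℕ.+ r Y)

record Multimatroid (n m : ℕ) : Set where
  field
    cls      : Fin n → Fin m
    cls-surj : ∀ ω → Σ (Fin n) λ u → cls u ≡ ω
    r        : Subset n → ℕ   -- only its values on subtransversals matter
    R1 : ∀ T → IsTransversal cls T → IsMatroidRankOn T r
    R2 : ∀ S x y → IsSubtransversal cls S → x ≢ y → cls x ≡ cls y →
         (∀ z → z ∈ S → cls z ≢ cls x) →
         suc (2 ℕ.* r S) ≤ r (S ∪ ⁅ x ⁆) ℕ.+ r (S ∪ ⁅ y ⁆)

module _ {n m : ℕ} (Z : Multimatroid n m) where
  open Multimatroid Z

  IsCircuit : Subset n → Set
  IsCircuit C = IsSubtransversal cls C × r C < ∣ C ∣ ×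
                (∀ D → D ⊂ C → ∣ D ∣ ≤ r D)

  module _ (_≺_ : Rel (Fin m) 0ℓ) where

    IsMin : Fin n → Subset n → Set
    IsMin x C = x ∈ C × (∀ y → y ∈ C → y ≢ x → cls x ≺ cls y)

    -- transversals encoded as choice vectors τ with cls (τ ω) ≡ ω;
    -- τ ω is T_ω and the transversal itself is the following subset
    toSubset : Vec (Fin n) m → Subset n
    toSubset τ = tabulate λ u → does (lookup τ (cls u) ≟ u)

    IsChoice : Vec (Fin n) m → Set
    IsChoice τ = ∀ ω → cls (lookup τ ω) ≡ ω

    Active : Subset n → Fin m → Set
    Active T ω = ∃ λ C → ∃ λ x → IsCircuit C × IsMin x C × cls x ≡ ω ×
                 (∀ y → y ∈ C → cls y ≢ ω → y ∈ T)

    Cocompatible : Subset n → Set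
    Cocompatible S = ¬ (∃ λ C → ∃ λ x → IsCircuit C × IsMin x C × x ∉ S ×
                        (∀ y → y ∈ C → y ≢ x → y ∈ S))

allFins : (n : ℕ) → List (Fin n)
allFins n = Data.List.allFin n

allVecs : (n m : ℕ) → List (Vec (Fin n) m)
allVecs n zero = [] ∷ []
allVecs n (suc m) = concatMap (λ i → map (i ∷_) (allVecs n m)) (allFins n)

module Sums {c ℓ} (R : CommutativeSemiring c ℓ) where
  open CommutativeSemiring R

  ΣL : {A : Set} → List A → (A → Carrier) → Carrier
  ΣL [] f = 0#
  ΣL (a ∷ as) f = f a + ΣL as f

  ΣF : (k : ℕ) → (Fin k → Carrier) → Carrier
  ΣF k f = ΣL (allFins k) f

  ΠF : (k : ℕ) → (Fin k → Carrier) → Carrier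
  ΠF zero f = 1#
  ΠF (suc k) f = f Fin.zero * ΠF k (λ i → f (Fin.suc i))

  pow : Carrier → ℕ → Carrier
  pow a zero = 1#
  pow a (suc k) = a * pow a k

  ΣT : {n m : ℕ} → (cls : Fin n → Fin m) →
       (Vec (Fin n) m → Bool) → (Vec (Fin n) m → Carrier) → Carrier
  ΣT {n} {m} cls p f =
    ΣL (allVecs n m) λ τ →
      if does (allChoice τ) then (if p τ then f τ else 0#) else 0#
    where
    open import Relation.Nullary.Decidable using (Dec)
    open import Data.Fin.Properties using (all?)
    allChoice : (τ : Vec (Fin n) m) → Dec (∀ ω → cls (lookup τ ω) ≡ ω)
    allChoice τ = all? λ ω → cls (lookup τ ω) ≟ ω

-- The two sides of Theorem 4.11, evaluated in a commutative semiring R at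
-- values x : U → R (for the indeterminates x_u) and t ∈ R.
-- (A polynomial identity over ℤ[x,t] with nonnegative coefficients holds
-- iff it holds under every such evaluation; take R = the polynomial semiring.)

module Sides {c ℓ} (R : CommutativeSemiring c ℓ) {n m : ℕ} (Z : Multimatroid n m)
             (_≺_ : Rel (Fin m) 0ℓ)
             (x : Fin n → CommutativeSemiring.Carrier R)
             (t : CommutativeSemiring.Carrier R) where
  open CommutativeSemiring R
  open Sums R
  open Multimatroid Z
  open import Data.Fin.Subset.Properties using (_∈?_)
  open import Data.Bool using (_∧_; not)

  Q : Carrier
  Q = ΣT cls (λ _ → true) λ τ →
        pow t (∣ toSubset Z _≺_ τ ∣ ℕ.∸ r (toSubset Z _≺_ τ)) *
        ΠF n (λ u → if does (u ∈? toSubset Z _≺_ τ) then x u else 1#)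

  -- right-hand side; the products over inact(T) and act(T) are merged into one
  -- product over all skew classes ω, with factor x_{T_ω} for inactive ω and
  -- (Σ_{e∈ω-{T_ω}} x_e + t x_{T_ω}) for active ω.
  RHS : (comp? : ∀ τ → Dec (Cocompatible Z _≺_ (toSubset Z _≺_ τ)))
        (act? : ∀ τ ω → Dec (Active Z _≺_ (toSubset Z _≺_ τ) ω)) → Carrier
  RHS comp? act? = ΣT cls (λ τ → does (comp? τ)) λ τ →
    ΠF m λ ω →
      if does (act? τ ω)
      then ΣF n (λ e → if does (cls e ≟ ω) ∧ not (does (e ≟ lookup τ ω))
                       then x e else 0#) + t * x (lookup τ ω)
      else x (lookup τ ω)

-- Write T≻ω for the elements of a transversal T in the skew classes above ω, and say that S spans e
-- when r (S ∪ {e}) = r S.  Circuits inside T≻ω ∪ {e} show that ω is active for T iff some element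
-- of ω is spanned by T≻ω, and that T is cocompatible iff no element of any ω other than T_ω is;
-- by (R2) at most one element of ω is spanned by T≻ω.  Adding the elements of T in decreasing
-- order raises the nullity exactly at the spanned T_ω, so Q = Σ_T Π_ω x_{T_ω} t^[T_ω spanned].
-- The classes are then processed one at a time: the factor of a processed class ω becomes the
-- right-hand side factor when T_ω is the only spanned element of ω (or there is none), and 0
-- otherwise.  Such a step preserves the sum: with T fixed outside a class k, which elements of k
-- are spanned does not depend on T_k, and if T_k is spanned then replacing it by another element
-- of k changes no spanned set of any other class (an exchange argument using (R2) once more), so
-- the sum over T_k factors through Σ_{e ∈ k} x_e t^[e spanned].

module Submission where

open import Defs
open import Level using (0ℓ)
open import Data.Nat as ℕ using (ℕ; zero; suc; _≤_; _<_; z≤n; s≤s)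
import Data.Nat.Properties as ℕ
open import Data.Fin using (Fin; zero; suc; toℕ; fromℕ<; punchIn; punchOut)
open import Data.Fin.Properties
  using (_≟_; any?; all?; ¬∀⟶∃¬; suc-injective; punchIn-punchOut; toℕ-injective; toℕ-fromℕ<; toℕ<n)
open import Data.Fin.Subset
open import Data.Fin.Subset.Properties
open import Data.Fin.Subset.Induction using (⊂-wellFounded; Acc; acc)
open import Data.Vec using (Vec; []; _∷_; tabulate; lookup; insertAt; here; there)
open import Data.Vec.Properties using (lookup∘tabulate; []=⇒lookup; lookup⇒[]=; insertAt-lookup; insertAt-punchIn)
open import Data.List as List using (List; []; _∷_; _++_; map; concatMap)
open import Data.Bool using (Bool; true; false; if_then_else_; _∧_; not)
open import Data.Product using (Σ; ∃; _×_; _,_; proj₁; proj₂)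
open import Data.Sum using (_⊎_; inj₁; inj₂; [_,_]′)
open import Data.Empty using (⊥-elim)
open import Function using (_∘_; _∘′_; id; _⇔_; mk⇔; Equivalence)
open import Relation.Nullary using (¬_; Dec; does; yes; no; _×-dec_; _→-dec_; ¬?)
open import Relation.Nullary.Decidable using (dec-true; dec-false; does-⇔; decidable-stable)
open import Relation.Unary using (Pred; Decidable)
open import Relation.Binary using (Rel; IsStrictTotalOrder; tri<; tri≈; tri>)
open import Relation.Binary.PropositionalEquality as ≡ using (_≡_; _≢_)
open import Algebra.Bundles using (CommutativeMonoid; CommutativeSemiring)

⟦_⟧ : ∀ {n ℓ} {P : Pred (Fin n) ℓ} → Decidable P → Subset n
⟦ P? ⟧ = tabulate λ u → does (P? u)

module _ {n ℓ} {P : Pred (Fin n) ℓ} (P? : Decidable P) {u : Fin n} where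

  ∈⟦⟧⁺ : P u → u ∈ ⟦ P? ⟧
  ∈⟦⟧⁺ pu = lookup⇒[]= u _ (≡.trans (lookup∘tabulate _ u) (dec-true (P? u) pu))

  ∈⟦⟧⁻ : u ∈ ⟦ P? ⟧ → P u
  ∈⟦⟧⁻ u∈ with P? u | ≡.trans (≡.sym (lookup∘tabulate (does ∘ P?) u)) ([]=⇒lookup u∈)
  ... | yes pu | _  = pu
  ... | no _   | ()

x∈p─q⇒x∉q : ∀ {n} {p q : Subset n} {x} → x ∈ p ─ q → x ∉ q
x∈p─q⇒x∉q {p = _ ∷ _} {outside ∷ _} here      ()
x∈p─q⇒x∉q {p = _ ∷ _} {_ ∷ _}       (there h) (there h′) = x∈p─q⇒x∉q h h′

x∈p-y⇒x≢y : ∀ {n} {p : Subset n} {x y} → x ∈ p - y → x ≢ y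
x∈p-y⇒x≢y h ≡.refl = x∈p─q⇒x∉q h (x∈⁅x⁆ _)

x∉p-x : ∀ {n} {p : Subset n} {x} → x ∉ p - x
x∉p-x h = x∈p-y⇒x≢y h ≡.refl

x∈p∪⁅y⁆⁻ : ∀ {n} {p : Subset n} {x y} → x ∈ p ∪ ⁅ y ⁆ → x ∈ p ⊎ x ≡ y
x∈p∪⁅y⁆⁻ {p = p} {y = y} h = [ inj₁ , inj₂ ∘ x∈⁅y⁆⇒x≡y y ]′ (x∈p∪q⁻ p ⁅ y ⁆ h)

x∈p∪⁅x⁆ : ∀ {n} {p : Subset n} {x} → x ∈ p ∪ ⁅ x ⁆
x∈p∪⁅x⁆ {p = p} {x} = q⊆p∪q p ⁅ x ⁆ (x∈⁅x⁆ x)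

p∪⁅x⁆⊆q : ∀ {n} {p q : Subset n} {x} → p ⊆ q → x ∈ q → p ∪ ⁅ x ⁆ ⊆ q
p∪⁅x⁆⊆q p⊆q x∈q h with x∈p∪⁅y⁆⁻ h
... | inj₁ h′   = p⊆q h′
... | inj₂ ≡.refl = x∈q

∪⁅⁆-mono : ∀ {n} {p q : Subset n} {x} → p ⊆ q → p ∪ ⁅ x ⁆ ⊆ q ∪ ⁅ x ⁆
∪⁅⁆-mono p⊆q = p∪⁅x⁆⊆q (p⊆p∪q _ ∘′ p⊆q) x∈p∪⁅x⁆

x∈p⇒p-x∪⁅x⁆≡p : ∀ {n} {p : Subset n} {x} → x ∈ p → (p - x) ∪ ⁅ x ⁆ ≡ p
x∈p⇒p-x∪⁅x⁆≡p {p = p} {x} x∈p = ⊆-antisym (p∪⁅x⁆⊆q (p─q⊆p p ⁅ x ⁆) x∈p) back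
  where
  back : p ⊆ (p - x) ∪ ⁅ x ⁆
  back {y} y∈p with y ≟ x
  ... | yes ≡.refl = x∈p∪⁅x⁆
  ... | no y≢x   = p⊆p∪q _ (x∈p∧x≢y⇒x∈p-y y∈p y≢x)

∪⁅⁆-comm : ∀ {n} (p : Subset n) x y → (p ∪ ⁅ x ⁆) ∪ ⁅ y ⁆ ≡ (p ∪ ⁅ y ⁆) ∪ ⁅ x ⁆
∪⁅⁆-comm p x y = begin
  (p ∪ ⁅ x ⁆) ∪ ⁅ y ⁆ ≡⟨ ∪-assoc p _ _ ⟩
  p ∪ (⁅ x ⁆ ∪ ⁅ y ⁆) ≡⟨ ≡.cong (p ∪_) (∪-comm ⁅ x ⁆ ⁅ y ⁆) ⟩
  p ∪ (⁅ y ⁆ ∪ ⁅ x ⁆) ≡⟨ ∪-assoc p _ _ ⟨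
  (p ∪ ⁅ y ⁆) ∪ ⁅ x ⁆ ∎
  where open ≡.≡-Reasoning

∣p∪⁅x⁆∣≡1+∣p∣ : ∀ {n} {p : Subset n} {x} → x ∉ p → ∣ p ∪ ⁅ x ⁆ ∣ ≡ suc ∣ p ∣
∣p∪⁅x⁆∣≡1+∣p∣ {p = outside ∷ p} {zero}  x∉p = ≡.cong (suc ∘ ∣_∣) (∪-identityʳ p)
∣p∪⁅x⁆∣≡1+∣p∣ {p = inside ∷ p}  {zero}  x∉p = ⊥-elim (x∉p here)
∣p∪⁅x⁆∣≡1+∣p∣ {p = outside ∷ p} {suc x} x∉p = ∣p∪⁅x⁆∣≡1+∣p∣ (x∉p ∘ there)
∣p∪⁅x⁆∣≡1+∣p∣ {p = inside ∷ p}  {suc x} x∉p = ≡.cong suc (∣p∪⁅x⁆∣≡1+∣p∣ (x∉p ∘ there))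

p⊆q⇒∣q∣≡∣p∣+∣q─p∣ : ∀ {n} {p q : Subset n} → p ⊆ q → ∣ q ∣ ≡ ∣ p ∣ ℕ.+ ∣ q ─ p ∣
p⊆q⇒∣q∣≡∣p∣+∣q─p∣ {p = []}          {[]}          _   = ≡.refl
p⊆q⇒∣q∣≡∣p∣+∣q─p∣ {p = inside ∷ p}  {inside ∷ q}  p⊆q = ≡.cong suc (p⊆q⇒∣q∣≡∣p∣+∣q─p∣ (drop-∷-⊆ p⊆q))
p⊆q⇒∣q∣≡∣p∣+∣q─p∣ {p = inside ∷ p}  {outside ∷ q} p⊆q with () ← p⊆q here
p⊆q⇒∣q∣≡∣p∣+∣q─p∣ {p = outside ∷ p} {inside ∷ q}  p⊆q =
  ≡.trans (≡.cong suc (p⊆q⇒∣q∣≡∣p∣+∣q─p∣ (drop-∷-⊆ p⊆q))) (≡.sym (ℕ.+-suc _ _))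
p⊆q⇒∣q∣≡∣p∣+∣q─p∣ {p = outside ∷ p} {outside ∷ q} p⊆q = p⊆q⇒∣q∣≡∣p∣+∣q─p∣ (drop-∷-⊆ p⊆q)

module Least {m : ℕ} {_≺_ : Rel (Fin m) 0ℓ} (sto : IsStrictTotalOrder _≡_ _≺_) where
  open IsStrictTotalOrder sto using (compare) renaming (trans to ≺-trans)

  IsLeast : Fin m → Subset m → Set
  IsLeast μ A = μ ∈ A × (∀ ω → ω ∈ A → ω ≢ μ → μ ≺ ω)

  least : ∀ A → Acc _⊂_ A → Nonempty A → ∃ λ μ → IsLeast μ A
  least A (acc rs) (u , u∈A) with nonempty? (A - u)
  ... | no empty = u , u∈A , λ ω ω∈A ω≢u → ⊥-elim (empty (ω , x∈p∧x≢y⇒x∈p-y ω∈A ω≢u))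
  ... | yes nonempty with least (A - u) (rs (x∈p⇒p-x⊂p u∈A)) nonempty
  ...   | μ , μ∈A-u , μ-least with compare u μ
  ...     | tri< u≺μ _ _ = u , u∈A , u-least
    where
    u-least : ∀ ω → ω ∈ A → ω ≢ u → u ≺ ω
    u-least ω ω∈A ω≢u with ω ≟ μ
    ... | yes ≡.refl = u≺μ
    ... | no ω≢μ   = ≺-trans u≺μ (μ-least ω (x∈p∧x≢y⇒x∈p-y ω∈A ω≢u) ω≢μ)
  ...     | tri≈ _ ≡.refl _ = ⊥-elim (x∉p-x μ∈A-u)
  ...     | tri> _ _ μ≺u = μ , p─q⊆p A ⁅ u ⁆ μ∈A-u , μ-least′
    where
    μ-least′ : ∀ ω → ω ∈ A → ω ≢ μ → μ ≺ ω
    μ-least′ ω ω∈A ω≢μ with ω ≟ u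
    ... | yes ≡.refl = μ≺u
    ... | no ω≢u   = μ-least ω (x∈p∧x≢y⇒x∈p-y ω∈A ω≢u) ω≢μ

insert : ∀ {A : Set} {m} → Vec A (ℕ.pred m) → Fin m → A → Vec A m
insert {m = suc m} = insertAt

insert-lookup : ∀ {A : Set} {m} (v : Vec A (ℕ.pred m)) (k : Fin m) (e : A) → lookup (insert v k e) k ≡ e
insert-lookup {m = suc m} v k e = insertAt-lookup v k e

insert-lookup-≢ : ∀ {A : Set} {m} (v : Vec A (ℕ.pred m)) {k ω : Fin m} (e e′ : A) → ω ≢ k →
                  lookup (insert v k e) ω ≡ lookup (insert v k e′) ω
insert-lookup-≢ {m = suc m} v {k} {ω} e e′ ω≢k = begin
  lookup (insertAt v k e) ω              ≡⟨ ≡.cong (lookup (insertAt v k e)) (punchIn-punchOut k≢ω) ⟨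
  lookup (insertAt v k e) (punchIn k j)  ≡⟨ insertAt-punchIn v k e j ⟩
  lookup v j                             ≡⟨ insertAt-punchIn v k e′ j ⟨
  lookup (insertAt v k e′) (punchIn k j) ≡⟨ ≡.cong (lookup (insertAt v k e′)) (punchIn-punchOut k≢ω) ⟩
  lookup (insertAt v k e′) ω             ∎
  where
  open ≡.≡-Reasoning
  k≢ω : k ≢ ω
  k≢ω = ω≢k ∘ ≡.sym
  j : Fin m
  j = punchOut k≢ω

module MonoidSums {c ℓ} (M : CommutativeMonoid c ℓ) where
  open CommutativeMonoid M
  open import Algebra.Properties.CommutativeMonoid.Sum M public
  open import Relation.Binary.Reasoning.Setoid setoid

  sum-zero : ∀ {k} {f : Fin k → Carrier} → (∀ i → f i ≈ ε) → sum f ≈ ε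
  sum-zero {zero}  f≈ε = refl
  sum-zero {suc k} f≈ε = trans (∙-cong (f≈ε zero) (sum-zero (f≈ε ∘ suc))) (identityˡ ε)

  sum-single : ∀ {k} (f : Fin k → Carrier) p → (∀ i → i ≢ p → f i ≈ ε) → sum f ≈ f p
  sum-single f zero    f≈ε = trans (∙-congˡ (sum-zero λ i → f≈ε (suc i) λ ())) (identityʳ _)
  sum-single f (suc p) f≈ε = trans (∙-congʳ (f≈ε zero λ ()))
    (trans (identityˡ _) (sum-single (f ∘ suc) p λ i i≢p → f≈ε (suc i) (i≢p ∘ suc-injective)))

  sum-extract : ∀ {k} (f g : Fin k → Carrier) p → (∀ i → i ≢ p → f i ≈ g i) →
                sum f ≈ f p ∙ sum (λ i → if does (i ≟ p) then ε else g i)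
  sum-extract f g p f≈g = begin
    sum f                       ≈⟨ sum-cong-≋ split ⟩
    sum (λ i → at i ∙ off i)    ≈⟨ ∑-distrib-+ at off ⟩
    sum at ∙ sum off            ≈⟨ ∙-congʳ (sum-single at p at-off) ⟩
    at p ∙ sum off              ≡⟨ ≡.cong (λ b → (if b then f p else ε) ∙ sum off) (dec-true (p ≟ p) ≡.refl) ⟩
    f p ∙ sum off               ∎
    where
    at off : Fin _ → Carrier
    at  i = if does (i ≟ p) then f i else ε
    off i = if does (i ≟ p) then ε else g i
    split : ∀ i → f i ≈ at i ∙ off i
    split i with i ≟ p
    ... | yes _  = sym (identityʳ _)
    ... | no i≢p = trans (f≈g i i≢p) (sym (identityˡ _))
    at-off : ∀ i → i ≢ p → at i ≈ ε
    at-off i i≢p rewrite dec-false (i ≟ p) i≢p = refl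

  sum∈ : ∀ {k} → Subset k → (Fin k → Carrier) → Carrier
  sum∈ X f = sum λ i → if does (i ∈? X) then f i else ε

  sum∈-⊥ : ∀ {k} (f : Fin k → Carrier) → sum∈ ⊥ f ≈ ε
  sum∈-⊥ f = sum-zero λ i → reflexive (≡.cong (λ b → if b then f i else ε) (dec-false (i ∈? ⊥) ∉⊥))

  sum∈-⊤ : ∀ {k} (f : Fin k → Carrier) → sum∈ ⊤ f ≈ sum f
  sum∈-⊤ f = sum-cong-≋ λ i → reflexive (≡.cong (λ b → if b then f i else ε) (dec-true (i ∈? ⊤) ∈⊤))

  sum∈-∪⁅⁆ : ∀ {k} {X : Subset k} {x} (f : Fin k → Carrier) → x ∉ X →
             sum∈ (X ∪ ⁅ x ⁆) f ≈ f x ∙ sum∈ X f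
  sum∈-∪⁅⁆ {X = X} {x} f x∉X = begin
    sum∈ (X ∪ ⁅ x ⁆) f ≈⟨ sum-extract g h x g≈h ⟩
    g x ∙ sum off       ≈⟨ ∙-cong (reflexive gx≡fx) (sum-cong-≋ off≈h) ⟩
    f x ∙ sum∈ X f      ∎
    where
    g h off : Fin _ → Carrier
    g i   = if does (i ∈? X ∪ ⁅ x ⁆) then f i else ε
    h i   = if does (i ∈? X) then f i else ε
    off i = if does (i ≟ x) then ε else h i
    gx≡fx : g x ≡ f x
    gx≡fx = ≡.cong (λ b → if b then f x else ε) (dec-true (x ∈? X ∪ ⁅ x ⁆) x∈p∪⁅x⁆)
    g≈h : ∀ i → i ≢ x → g i ≈ h i
    g≈h i i≢x = reflexive (≡.cong (λ b → if b then f i else ε)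
      (does-⇔ (mk⇔ (λ i∈ → [ id , (λ i≡x → ⊥-elim (i≢x i≡x)) ]′ (x∈p∪⁅y⁆⁻ i∈)) (p⊆p∪q _))
              (i ∈? X ∪ ⁅ x ⁆) (i ∈? X)))
    off≈h : ∀ i → off i ≈ h i
    off≈h i with i ≟ x
    ... | yes ≡.refl = reflexive (≡.cong (λ b → if b then f i else ε) (≡.sym (dec-false (i ∈? X) x∉X)))
    ... | no _       = refl

module SemiringSums {c ℓ} (R : CommutativeSemiring c ℓ) where
  open CommutativeSemiring R hiding (zero)
  open Sums R
  open import Relation.Binary.Reasoning.Setoid setoid
  module Sum = MonoidSums +-commutativeMonoid
  module Prod = MonoidSums *-commutativeMonoid

  ∑ ∏ : ∀ {k} → (Fin k → Carrier) → Carrier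
  ∑ = Sum.sum
  ∏ = Prod.sum

  ΣL-tabulate : ∀ {A : Set} k (g : Fin k → A) f → ΣL (List.tabulate g) f ≡ ∑ (f ∘ g)
  ΣL-tabulate zero    g f = ≡.refl
  ΣL-tabulate (suc k) g f = ≡.cong (f (g zero) +_) (ΣL-tabulate k (g ∘ suc) f)

  ΣF≡∑ : ∀ k f → ΣF k f ≡ ∑ f
  ΣF≡∑ k = ΣL-tabulate k id

  ΠF≡∏ : ∀ k f → ΠF k f ≡ ∏ f
  ΠF≡∏ zero    f = ≡.refl
  ΠF≡∏ (suc k) f = ≡.cong (f zero *_) (ΠF≡∏ k (f ∘ suc))

  ΣL-cong : ∀ {A : Set} (L : List A) {f g : A → Carrier} → (∀ a → f a ≈ g a) → ΣL L f ≈ ΣL L g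
  ΣL-cong []      f≈g = refl
  ΣL-cong (a ∷ L) f≈g = +-cong (f≈g a) (ΣL-cong L f≈g)

  ΣL-++ : ∀ {A : Set} (L M : List A) f → ΣL (L ++ M) f ≈ ΣL L f + ΣL M f
  ΣL-++ []      M f = sym (+-identityˡ _)
  ΣL-++ (a ∷ L) M f = trans (+-congˡ (ΣL-++ L M f)) (sym (+-assoc _ _ _))

  ΣL-map : ∀ {A B : Set} (L : List A) (h : A → B) f → ΣL (map h L) f ≡ ΣL L (f ∘ h)
  ΣL-map []      h f = ≡.refl
  ΣL-map (a ∷ L) h f = ≡.cong (f (h a) +_) (ΣL-map L h f)

  ΣL-concatMap : ∀ {A B : Set} (L : List A) (g : A → List B) f →
                 ΣL (concatMap g L) f ≈ ΣL L (λ a → ΣL (g a) f)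
  ΣL-concatMap []      g f = refl
  ΣL-concatMap (a ∷ L) g f = trans (ΣL-++ (g a) (concatMap g L) f) (+-congˡ (ΣL-concatMap L g f))

  ΣL-∑-comm : ∀ {A : Set} {k} (L : List A) (f : A → Fin k → Carrier) →
              ΣL L (λ a → ∑ (f a)) ≈ ∑ (λ i → ΣL L (λ a → f a i))
  ΣL-∑-comm {k = k} []      f = sym (Sum.sum-zero {k} λ _ → refl)
  ΣL-∑-comm (a ∷ L) f = trans (+-congˡ (ΣL-∑-comm L f)) (sym (Sum.∑-distrib-+ (f a) _))

  ΣL-allVecs-suc : ∀ {n m} (F : Vec (Fin n) (suc m) → Carrier) →
                   ΣL (allVecs n (suc m)) F ≈ ∑ (λ i → ΣL (allVecs n m) (F ∘ (i ∷_)))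
  ΣL-allVecs-suc {n} {m} F = begin
    ΣL (allVecs n (suc m)) F
      ≈⟨ ΣL-concatMap (allFins n) _ F ⟩
    ΣL (allFins n) (λ i → ΣL (map (i ∷_) (allVecs n m)) F)
      ≈⟨ ΣL-cong (allFins n) (λ i → reflexive (ΣL-map (allVecs n m) (i ∷_) F)) ⟩
    ΣL (allFins n) (λ i → ΣL (allVecs n m) (F ∘ (i ∷_)))
      ≡⟨ ΣF≡∑ n _ ⟩
    ∑ (λ i → ΣL (allVecs n m) (F ∘ (i ∷_))) ∎

  ΣL-allVecs-insert : ∀ {n m} (k : Fin m) (F : Vec (Fin n) m → Carrier) →
                      ΣL (allVecs n m) F ≈ ΣL (allVecs n (ℕ.pred m)) (λ v → ∑ (λ e → F (insert v k e)))
  ΣL-allVecs-insert {n} {suc m} zero F = begin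
    ΣL (allVecs n (suc m)) F                          ≈⟨ ΣL-allVecs-suc F ⟩
    ∑ (λ e → ΣL (allVecs n m) (λ v → F (e ∷ v)))      ≈⟨ ΣL-∑-comm (allVecs n m) (λ v e → F (e ∷ v)) ⟨
    ΣL (allVecs n m) (λ v → ∑ (λ e → F (e ∷ v)))      ∎
  ΣL-allVecs-insert {n} {suc (suc m)} (suc k) F = begin
    ΣL (allVecs n (suc (suc m))) F
      ≈⟨ ΣL-allVecs-suc F ⟩
    ∑ (λ i → ΣL (allVecs n (suc m)) (F ∘ (i ∷_)))
      ≈⟨ Sum.sum-cong-≋ (λ i → ΣL-allVecs-insert k (F ∘ (i ∷_))) ⟩
    ∑ (λ i → ΣL (allVecs n m) (λ w → ∑ (λ e → F (i ∷ insertAt w k e))))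
      ≈⟨ ΣL-allVecs-suc (λ v → ∑ (λ e → F (insertAt v (suc k) e))) ⟨
    ΣL (allVecs n (suc m)) (λ v → ∑ (λ e → F (insertAt v (suc k) e))) ∎

  if-cong : ∀ b {X X′ Y Y′} → X ≈ X′ → Y ≈ Y′ → (if b then X else Y) ≈ (if b then X′ else Y′)
  if-cong true  X≈X′ _ = X≈X′
  if-cong false _ Y≈Y′ = Y≈Y′

  ∏-zero : ∀ {k} (f : Fin k → Carrier) p → f p ≈ 0# → ∏ f ≈ 0#
  ∏-zero f p fp≈0 = trans (Prod.sum-extract f f p (λ _ _ → refl)) (trans (*-congʳ fp≈0) (zeroˡ _))

  if-dec : ∀ {a} {A : Set a} (d : Dec A) {X Y W} → (A → X ≈ W) → (¬ A → Y ≈ W) → (if does d then X else Y) ≈ W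
  if-dec (yes a) X≈W _ = X≈W a
  if-dec (no ¬a) _ Y≈W = Y≈W ¬a

module MultimatroidRank {n m : ℕ} (Z : Multimatroid n m) where
  open ≡ using (refl; sym; trans; cong; cong₂; subst; subst₂)
  open Multimatroid Z

  Subtransversal : Subset n → Set
  Subtransversal = IsSubtransversal cls

  Avoids : Subset n → Fin m → Set
  Avoids S ω = ∀ z → z ∈ S → cls z ≢ ω

  subtransversal-⊆ : ∀ {X Y} → X ⊆ Y → Subtransversal Y → Subtransversal X
  subtransversal-⊆ X⊆Y subY x y x∈X y∈X = subY x y (X⊆Y x∈X) (X⊆Y y∈X)

  subtransversal-∪⁅⁆ : ∀ {S e} → Subtransversal S → Avoids S (cls e) → Subtransversal (S ∪ ⁅ e ⁆)
  subtransversal-∪⁅⁆ {S} {e} subS avoids x y x∈ y∈ cx≡cy with x∈p∪⁅y⁆⁻ x∈ | x∈p∪⁅y⁆⁻ y∈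
  ... | inj₁ x∈S | inj₁ y∈S = subS x y x∈S y∈S cx≡cy
  ... | inj₁ x∈S | inj₂ refl = ⊥-elim (avoids x x∈S cx≡cy)
  ... | inj₂ refl | inj₁ y∈S = ⊥-elim (avoids y y∈S (sym cx≡cy))
  ... | inj₂ refl | inj₂ refl = refl

  module _ (S : Subset n) where
    private
      pick : ∀ ω → Dec (∃ λ v → v ∈ S × cls v ≡ ω) → Fin n
      pick ω (yes (v , _)) = v
      pick ω (no _)        = proj₁ (cls-surj ω)

      pick-cls : ∀ ω d → cls (pick ω d) ≡ ω
      pick-cls ω (yes (_ , _ , cv≡ω)) = cv≡ω
      pick-cls ω (no _)               = proj₂ (cls-surj ω)

      pick-∈ : Subtransversal S → ∀ {u} → u ∈ S → ∀ d → pick (cls u) d ≡ u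
      pick-∈ subS u∈S (yes (v , v∈S , cv≡cu)) = subS _ _ v∈S u∈S cv≡cu
      pick-∈ subS u∈S (no none)               = ⊥-elim (none (_ , u∈S , refl))

      met? : ∀ ω → Dec (∃ λ v → v ∈ S × cls v ≡ ω)
      met? ω = any? λ v → (v ∈? S) ×-dec (cls v ≟ ω)

      completion : Fin m → Fin n
      completion ω = pick ω (met? ω)

    extension : Subset n
    extension = ⟦ (λ u → completion (cls u) ≟ u) ⟧

    extension-transversal : IsTransversal cls extension
    extension-transversal = sub , cover
      where
      sub : Subtransversal extension
      sub x y x∈ y∈ cx≡cy =
        trans (sym (∈⟦⟧⁻ (λ u → completion (cls u) ≟ u) x∈))
              (trans (cong completion cx≡cy) (∈⟦⟧⁻ (λ u → completion (cls u) ≟ u) y∈))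
      cover : ∀ ω → Σ (Fin n) λ u → cls u ≡ ω × u ∈ extension
      cover ω = completion ω , pick-cls ω (met? ω) ,
                ∈⟦⟧⁺ (λ u → completion (cls u) ≟ u) (cong completion (pick-cls ω (met? ω)))

    ⊆extension : Subtransversal S → S ⊆ extension
    ⊆extension subS u∈S = ∈⟦⟧⁺ (λ u → completion (cls u) ≟ u) (pick-∈ subS u∈S (met? _))

  -- (R1) reaches the subsets of a subtransversal through a transversal containing it.
  private
    rankOn : ∀ {S} → Subtransversal S → IsMatroidRankOn (extension S) r
    rankOn {S} _ = R1 (extension S) (extension-transversal S)

  rank≤card : ∀ {X} → Subtransversal X → r X ≤ ∣ X ∣
  rank≤card {X} subX = proj₁ (rankOn subX) X (⊆extension X subX)

  rank-mono : ∀ {X Y} → Subtransversal Y → X ⊆ Y → r X ≤ r Y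
  rank-mono {X} {Y} subY X⊆Y = proj₁ (proj₂ (rankOn subY)) X Y X⊆Y (⊆extension Y subY)

  rank-submod : ∀ {X Y} → Subtransversal (X ∪ Y) → r (X ∪ Y) ℕ.+ r (X ∩ Y) ≤ r X ℕ.+ r Y
  rank-submod {X} {Y} sub = proj₂ (proj₂ (rankOn sub)) X Y
    (⊆extension _ sub ∘ p⊆p∪q Y) (⊆extension _ sub ∘ q⊆p∪q X Y)

  rank-⊥ : r ⊥ ≡ 0
  rank-⊥ = ℕ.n≤0⇒n≡0 (subst (r ⊥ ≤_) (∣⊥∣≡0 n) (rank≤card λ _ _ x∈⊥ → ⊥-elim (∉⊥ x∈⊥)))

  rank-diminishing : ∀ {X Y e} → X ⊆ Y → Subtransversal (Y ∪ ⁅ e ⁆) →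
                     r (Y ∪ ⁅ e ⁆) ℕ.+ r X ≤ r Y ℕ.+ r (X ∪ ⁅ e ⁆)
  rank-diminishing {X} {Y} {e} X⊆Y subYe = begin
    r (Y ∪ ⁅ e ⁆) ℕ.+ r X                      ≤⟨ ℕ.+-monoʳ-≤ _ (rank-mono subI X⊆I) ⟩
    r (Y ∪ ⁅ e ⁆) ℕ.+ r (Y ∩ (X ∪ ⁅ e ⁆))      ≡⟨ cong (λ U → r U ℕ.+ r (Y ∩ (X ∪ ⁅ e ⁆))) U≡ ⟨
    r (Y ∪ (X ∪ ⁅ e ⁆)) ℕ.+ r (Y ∩ (X ∪ ⁅ e ⁆)) ≤⟨ rank-submod (subst Subtransversal (sym U≡) subYe) ⟩
    r Y ℕ.+ r (X ∪ ⁅ e ⁆)                      ∎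
    where
    open ℕ.≤-Reasoning
    U≡ : Y ∪ (X ∪ ⁅ e ⁆) ≡ Y ∪ ⁅ e ⁆
    U≡ = ⊆-antisym (λ h → [ p⊆p∪q _ , ∪⁅⁆-mono X⊆Y ]′ (x∈p∪q⁻ Y _ h))
                   (p∪⁅x⁆⊆q (p⊆p∪q _) (q⊆p∪q Y _ x∈p∪⁅x⁆))
    subI : Subtransversal (Y ∩ (X ∪ ⁅ e ⁆))
    subI = subtransversal-⊆ (p⊆p∪q _ ∘ p∩q⊆p Y _) subYe
    X⊆I : X ⊆ Y ∩ (X ∪ ⁅ e ⁆)
    X⊆I x∈X = x∈p∩q⁺ (X⊆Y x∈X , p⊆p∪q _ x∈X)

  rank-∪⁅⁆≤ : ∀ {S e} → Subtransversal (S ∪ ⁅ e ⁆) → r (S ∪ ⁅ e ⁆) ≤ suc (r S)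
  rank-∪⁅⁆≤ {S} {e} subSe = begin
    r (S ∪ ⁅ e ⁆)               ≡⟨ ℕ.+-identityʳ _ ⟨
    r (S ∪ ⁅ e ⁆) ℕ.+ 0         ≡⟨ cong (r (S ∪ ⁅ e ⁆) ℕ.+_) rank-⊥ ⟨
    r (S ∪ ⁅ e ⁆) ℕ.+ r ⊥       ≤⟨ rank-diminishing ⊥⊆ subSe ⟩
    r S ℕ.+ r (⊥ ∪ ⁅ e ⁆)       ≤⟨ ℕ.+-monoʳ-≤ (r S) (rank≤card (subtransversal-⊆ (∪⁅⁆-mono ⊥⊆) subSe)) ⟩
    r S ℕ.+ ∣ ⊥ ∪ ⁅ e ⁆ ∣       ≡⟨ cong (r S ℕ.+_) (trans (∣p∪⁅x⁆∣≡1+∣p∣ {p = ⊥} {e} ∉⊥) (cong suc (∣⊥∣≡0 n))) ⟩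
    r S ℕ.+ 1                   ≡⟨ ℕ.+-comm (r S) 1 ⟩
    suc (r S)                   ∎
    where open ℕ.≤-Reasoning

  Spans : Subset n → Fin n → Set
  Spans S e = r (S ∪ ⁅ e ⁆) ≡ r S

  spans? : ∀ S e → Dec (Spans S e)
  spans? S e = r (S ∪ ⁅ e ⁆) ℕ.≟ r S

  ≤⇒spans : ∀ {S e} → Subtransversal (S ∪ ⁅ e ⁆) → r (S ∪ ⁅ e ⁆) ≤ r S → Spans S e
  ≤⇒spans subSe ≤rS = ℕ.≤-antisym ≤rS (rank-mono subSe (p⊆p∪q _))

  ¬spans⇒rank-suc : ∀ {S e} → Subtransversal (S ∪ ⁅ e ⁆) → ¬ Spans S e → r (S ∪ ⁅ e ⁆) ≡ suc (r S)
  ¬spans⇒rank-suc subSe ¬spans with ℕ.m≤n⇒m<n∨m≡n (rank-∪⁅⁆≤ subSe)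
  ... | inj₁ (s≤s ≤rS) = ⊥-elim (¬spans (≤⇒spans subSe ≤rS))
  ... | inj₂ ≡suc      = ≡suc

  spans-mono : ∀ {X Y e} → X ⊆ Y → Subtransversal (Y ∪ ⁅ e ⁆) → Spans X e → Spans Y e
  spans-mono {X} {Y} {e} X⊆Y subYe spansX = ≤⇒spans subYe (ℕ.+-cancelʳ-≤ (r X) _ _ (begin
    r (Y ∪ ⁅ e ⁆) ℕ.+ r X   ≤⟨ rank-diminishing X⊆Y subYe ⟩
    r Y ℕ.+ r (X ∪ ⁅ e ⁆)   ≡⟨ cong (r Y ℕ.+_) spansX ⟩
    r Y ℕ.+ r X             ∎))
    where open ℕ.≤-Reasoning

  skew-not-both : ∀ {S a b} → Subtransversal S → Avoids S (cls a) → a ≢ b → cls a ≡ cls b →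
                  Spans S a → ¬ Spans S b
  skew-not-both {S} {a} {b} subS avoids a≢b ca≡cb spans-a spans-b =
    ℕ.<-irrefl refl (subst (λ k → suc (r S ℕ.+ k) ≤ r S ℕ.+ r S) (ℕ.+-identityʳ (r S))
      (subst₂ (λ ra rb → suc (2 ℕ.* r S) ≤ ra ℕ.+ rb) spans-a spans-b (R2 S a b subS a≢b ca≡cb avoids)))

  spans-absorb : ∀ {S a e} → Subtransversal ((S ∪ ⁅ a ⁆) ∪ ⁅ e ⁆) → Spans S a → Spans (S ∪ ⁅ a ⁆) e → Spans S e
  spans-absorb {S} {a} {e} sub spans-a spans-e = ≤⇒spans (subtransversal-⊆ (∪⁅⁆-mono (p⊆p∪q _)) sub) (begin
    r (S ∪ ⁅ e ⁆)            ≤⟨ rank-mono sub (∪⁅⁆-mono (p⊆p∪q _)) ⟩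
    r ((S ∪ ⁅ a ⁆) ∪ ⁅ e ⁆)  ≡⟨ trans spans-e spans-a ⟩
    r S                      ∎)
    where open ℕ.≤-Reasoning

  spans-transfer : ∀ {S a b e} → Subtransversal ((S ∪ ⁅ a ⁆) ∪ ⁅ e ⁆) → Subtransversal ((S ∪ ⁅ b ⁆) ∪ ⁅ e ⁆) →
                   Avoids (S ∪ ⁅ e ⁆) (cls a) → a ≢ b → cls a ≡ cls b →
                   Spans S a → Spans (S ∪ ⁅ b ⁆) e → Spans S e
  -- Otherwise S ∪ {e} would span both a and b, against (R2).
  spans-transfer {S} {a} {b} {e} subSae subSbe avoids a≢b ca≡cb spans-a spans-e with spans? S e
  ... | yes spans = spans
  ... | no ¬spans = ⊥-elim (skew-not-both subSe avoids a≢b ca≡cb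
                      (≤⇒spans (subst Subtransversal (∪⁅⁆-comm S a e) subSae) ≤a)
                      (≤⇒spans (subst Subtransversal (∪⁅⁆-comm S b e) subSbe) ≤b))
    where
    open ℕ.≤-Reasoning
    subSe : Subtransversal (S ∪ ⁅ e ⁆)
    subSe = subtransversal-⊆ (∪⁅⁆-mono (p⊆p∪q _)) subSae
    ≤a : r ((S ∪ ⁅ e ⁆) ∪ ⁅ a ⁆) ≤ r (S ∪ ⁅ e ⁆)
    ≤a = begin
      r ((S ∪ ⁅ e ⁆) ∪ ⁅ a ⁆) ≡⟨ cong r (∪⁅⁆-comm S e a) ⟩
      r ((S ∪ ⁅ a ⁆) ∪ ⁅ e ⁆) ≤⟨ rank-∪⁅⁆≤ subSae ⟩
      suc (r (S ∪ ⁅ a ⁆))     ≡⟨ cong suc spans-a ⟩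
      suc (r S)               ≡⟨ ¬spans⇒rank-suc subSe ¬spans ⟨
      r (S ∪ ⁅ e ⁆)           ∎
    ≤b : r ((S ∪ ⁅ e ⁆) ∪ ⁅ b ⁆) ≤ r (S ∪ ⁅ e ⁆)
    ≤b = begin
      r ((S ∪ ⁅ e ⁆) ∪ ⁅ b ⁆) ≡⟨ cong r (∪⁅⁆-comm S e b) ⟩
      r ((S ∪ ⁅ b ⁆) ∪ ⁅ e ⁆) ≡⟨ spans-e ⟩
      r (S ∪ ⁅ b ⁆)           ≤⟨ rank-∪⁅⁆≤ (subtransversal-⊆ (p⊆p∪q _) subSbe) ⟩
      suc (r S)               ≡⟨ ¬spans⇒rank-suc subSe ¬spans ⟨
      r (S ∪ ⁅ e ⁆)           ∎

  spans-swap : ∀ {S a b e} → Subtransversal S → Avoids S (cls a) → Avoids S (cls e) →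
               cls a ≡ cls b → cls e ≢ cls a → Spans S a →
               Spans (S ∪ ⁅ a ⁆) e ⇔ Spans (S ∪ ⁅ b ⁆) e
  spans-swap {S} {a} {b} {e} subS avoids-a avoids-e ca≡cb ce≢ca spans-a with a ≟ b
  ... | yes refl = mk⇔ id id
  ... | no a≢b   = mk⇔
    (spans-mono (p⊆p∪q _) (sub b (sym ca≡cb)) ∘ spans-absorb (sub a refl) spans-a)
    (spans-mono (p⊆p∪q _) (sub a refl) ∘ spans-transfer (sub a refl) (sub b (sym ca≡cb)) avoids-a′ a≢b ca≡cb spans-a)
    where
    sub : ∀ c → cls c ≡ cls a → Subtransversal ((S ∪ ⁅ c ⁆) ∪ ⁅ e ⁆)
    sub c cc≡ca = subtransversal-∪⁅⁆ (subtransversal-∪⁅⁆ subS (subst (Avoids S) (sym cc≡ca) avoids-a))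
      λ z z∈ → [ avoids-e z , (λ { refl cc≡ce → ce≢ca (trans (sym cc≡ce) cc≡ca) }) ]′ (x∈p∪⁅y⁆⁻ z∈)
    avoids-a′ : Avoids (S ∪ ⁅ e ⁆) (cls a)
    avoids-a′ z z∈ = [ avoids-a z , (λ { refl → ce≢ca }) ]′ (x∈p∪⁅y⁆⁻ z∈)

  Independent : Subset n → Set
  Independent X = ∣ X ∣ ≤ r X

  independent-⊆ : ∀ {X Y} → Subtransversal Y → Independent Y → X ⊆ Y → Independent X
  independent-⊆ {X} {Y} subY indY X⊆Y = ℕ.+-cancelʳ-≤ ∣ E ∣ ∣ X ∣ (r X) (begin
    ∣ X ∣ ℕ.+ ∣ E ∣                  ≡⟨ p⊆q⇒∣q∣≡∣p∣+∣q─p∣ X⊆Y ⟨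
    ∣ Y ∣                            ≤⟨ indY ⟩
    r Y                              ≤⟨ rank-mono subXE Y⊆XE ⟩
    r (X ∪ E)                        ≤⟨ ℕ.m≤m+n _ _ ⟩
    r (X ∪ E) ℕ.+ r (X ∩ E)          ≤⟨ rank-submod subXE ⟩
    r X ℕ.+ r E                      ≤⟨ ℕ.+-monoʳ-≤ (r X) (rank≤card (subtransversal-⊆ (p─q⊆p Y X) subY)) ⟩
    r X ℕ.+ ∣ E ∣                    ∎)
    where
    open ℕ.≤-Reasoning
    E = Y ─ X
    subXE : Subtransversal (X ∪ E)
    subXE = subtransversal-⊆ (λ h → [ X⊆Y , p─q⊆p Y X ]′ (x∈p∪q⁻ X E h)) subY
    Y⊆XE : Y ⊆ X ∪ E
    Y⊆XE {u} u∈Y with u ∈? X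
    ... | yes u∈X = p⊆p∪q E u∈X
    ... | no u∉X  = q⊆p∪q X E (x∈p∧x∉q⇒x∈p─q u∈Y u∉X)

  circuit⇒spans : ∀ {C S x} → IsCircuit Z C → x ∈ C → C - x ⊆ S → Subtransversal (S ∪ ⁅ x ⁆) →
                  Spans S x
  circuit⇒spans {C} {S} {x} (subC , dependent , minimal) x∈C C-x⊆S subSx =
    spans-mono C-x⊆S subSx (≤⇒spans (subst Subtransversal (sym C≡) subC) (begin
      r ((C - x) ∪ ⁅ x ⁆)   ≡⟨ cong r C≡ ⟩
      r C                   ≤⟨ ℕ.≤-pred (subst (r C <_) ∣C∣≡ dependent) ⟩
      ∣ C - x ∣             ≤⟨ minimal (C - x) (x∈p⇒p-x⊂p x∈C) ⟩
      r (C - x)             ∎))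
    where
    open ℕ.≤-Reasoning
    C≡ : (C - x) ∪ ⁅ x ⁆ ≡ C
    C≡ = x∈p⇒p-x∪⁅x⁆≡p x∈C
    ∣C∣≡ : ∣ C ∣ ≡ suc ∣ C - x ∣
    ∣C∣≡ = trans (cong ∣_∣ (sym C≡)) (∣p∪⁅x⁆∣≡1+∣p∣ (x∉p-x {p = C}))

  ∪⁅⁆-circuit : ∀ {I e} → Subtransversal (I ∪ ⁅ e ⁆) → e ∉ I → Independent I → Spans I e →
                (∀ g → g ∈ I → ¬ Spans (I - g) e) → IsCircuit Z (I ∪ ⁅ e ⁆)
  ∪⁅⁆-circuit {I} {e} subIe e∉I indI spans-e minimal-I = subIe , dependent , minimal
    where
    open ℕ.≤-Reasoning
    dependent : r (I ∪ ⁅ e ⁆) < ∣ I ∪ ⁅ e ⁆ ∣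
    dependent = begin-strict
      r (I ∪ ⁅ e ⁆)  ≡⟨ spans-e ⟩
      r I            ≤⟨ rank≤card (subtransversal-⊆ (p⊆p∪q _) subIe) ⟩
      ∣ I ∣          <⟨ ℕ.n<1+n _ ⟩
      suc ∣ I ∣      ≡⟨ ∣p∪⁅x⁆∣≡1+∣p∣ e∉I ⟨
      ∣ I ∪ ⁅ e ⁆ ∣  ∎
    minimal : ∀ D → D ⊂ I ∪ ⁅ e ⁆ → Independent D
    minimal D (D⊆ , g , g∈ , g∉D) with x∈p∪⁅y⁆⁻ g∈
    ... | inj₂ refl = independent-⊆ (subtransversal-⊆ (p⊆p∪q _) subIe) indI D⊆I
      where
      D⊆I : D ⊆ I
      D⊆I {u} u∈D = [ id , (λ { refl → ⊥-elim (g∉D u∈D) }) ]′ (x∈p∪⁅y⁆⁻ (D⊆ u∈D))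
    ... | inj₁ g∈I = independent-⊆ subK indK D⊆K
      where
      K = (I - g) ∪ ⁅ e ⁆
      subK : Subtransversal K
      subK = subtransversal-⊆ (∪⁅⁆-mono (p─q⊆p I ⁅ g ⁆)) subIe
      indK : Independent K
      indK = begin
        ∣ K ∣               ≡⟨ ∣p∪⁅x⁆∣≡1+∣p∣ (e∉I ∘ p─q⊆p I ⁅ g ⁆) ⟩
        suc ∣ I - g ∣       ≤⟨ s≤s (independent-⊆ (subtransversal-⊆ (p⊆p∪q _) subIe) indI (p─q⊆p I ⁅ g ⁆)) ⟩
        suc (r (I - g))     ≡⟨ ¬spans⇒rank-suc subK (minimal-I g g∈I) ⟨
        r K                 ∎
      D⊆K : D ⊆ K
      D⊆K {u} u∈D with x∈p∪⁅y⁆⁻ (D⊆ u∈D)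
      ... | inj₁ u∈I  = p⊆p∪q _ (x∈p∧x≢y⇒x∈p-y u∈I λ { refl → g∉D u∈D })
      ... | inj₂ refl = x∈p∪⁅x⁆

  private
    circuit-through : ∀ {e} I → Acc _⊂_ I → Subtransversal (I ∪ ⁅ e ⁆) → e ∉ I → Independent I →
                      Spans I e → ∃ λ C → IsCircuit Z C × e ∈ C × C ⊆ I ∪ ⁅ e ⁆
    circuit-through {e} I (acc rs) subIe e∉I indI spans-e
      with any? (λ g → (g ∈? I) ×-dec spans? (I - g) e)
    ... | no none = I ∪ ⁅ e ⁆ , ∪⁅⁆-circuit subIe e∉I indI spans-e (λ g g∈I spans → none (g , g∈I , spans)) ,
                    x∈p∪⁅x⁆ , id
    ... | yes (g , g∈I , spans-g) =
      let C , circuit , e∈C , C⊆ = circuit-through (I - g) (rs (x∈p⇒p-x⊂p g∈I))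
                                     (subtransversal-⊆ (∪⁅⁆-mono I-g⊆I) subIe) (e∉I ∘ I-g⊆I)
                                     (independent-⊆ (subtransversal-⊆ (p⊆p∪q _) subIe) indI I-g⊆I) spans-g
      in C , circuit , e∈C , ∪⁅⁆-mono I-g⊆I ∘ C⊆
      where
      I-g⊆I : I - g ⊆ I
      I-g⊆I = p─q⊆p I ⁅ g ⁆

  IsBasisOf : Subset n → Subset n → Set
  IsBasisOf I S = I ⊆ S × Independent I × r I ≡ r S

  private
    basis-∪⁅⁆ : ∀ {I X u} → Subtransversal (X ∪ ⁅ u ⁆) → u ∉ X → IsBasisOf I X →
                ∃ λ I′ → IsBasisOf I′ (X ∪ ⁅ u ⁆)
    basis-∪⁅⁆ {I} {X} {u} subXu u∉X (I⊆X , indI , rI≡rX) with spans? X u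
    ... | yes spans-u = I , p⊆p∪q _ ∘ I⊆X , indI , trans rI≡rX (sym spans-u)
    ... | no ¬spans-u = I ∪ ⁅ u ⁆ , ∪⁅⁆-mono I⊆X , indIu ,
                        trans rIu≡ (trans (cong suc rI≡rX) (sym (¬spans⇒rank-suc subXu ¬spans-u)))
      where
      subIu : Subtransversal (I ∪ ⁅ u ⁆)
      subIu = subtransversal-⊆ (∪⁅⁆-mono I⊆X) subXu
      rIu≡ : r (I ∪ ⁅ u ⁆) ≡ suc (r I)
      rIu≡ = ¬spans⇒rank-suc subIu (¬spans-u ∘ spans-mono I⊆X subXu)
      indIu : Independent (I ∪ ⁅ u ⁆)
      indIu = subst₂ _≤_ (sym (∣p∪⁅x⁆∣≡1+∣p∣ (u∉X ∘ I⊆X))) (sym rIu≡) (s≤s indI)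

    basis : ∀ S → Acc _⊂_ S → Subtransversal S → ∃ λ I → IsBasisOf I S
    basis S (acc rs) subS with nonempty? S
    ... | no empty = ⊥ , ⊥⊆ , subst (_≤ r ⊥) (sym (∣⊥∣≡0 n)) z≤n , cong r (sym (Empty-unique empty))
    ... | yes (u , u∈S) =
      let I , basisI = basis (S - u) (rs (x∈p⇒p-x⊂p u∈S)) (subtransversal-⊆ (p─q⊆p S ⁅ u ⁆) subS)
      in subst (λ S′ → ∃ λ I′ → IsBasisOf I′ S′) (x∈p⇒p-x∪⁅x⁆≡p u∈S)
           (basis-∪⁅⁆ (subst Subtransversal (sym (x∈p⇒p-x∪⁅x⁆≡p u∈S)) subS) x∉p-x basisI)

  spans⇒circuit : ∀ {S e} → Subtransversal (S ∪ ⁅ e ⁆) → e ∉ S → Spans S e →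
                  ∃ λ C → IsCircuit Z C × e ∈ C × C ⊆ S ∪ ⁅ e ⁆
  spans⇒circuit {S} {e} subSe e∉S spans-e with basis S (⊂-wellFounded S) (subtransversal-⊆ (p⊆p∪q _) subSe)
  ... | I , I⊆S , indI , rI≡rS =
    let C , circuit , e∈C , C⊆ = circuit-through I (⊂-wellFounded I) subIe (e∉S ∘ I⊆S) indI spans-Ie
    in C , circuit , e∈C , ∪⁅⁆-mono I⊆S ∘ C⊆
    where
    open ℕ.≤-Reasoning
    subIe : Subtransversal (I ∪ ⁅ e ⁆)
    subIe = subtransversal-⊆ (∪⁅⁆-mono I⊆S) subSe
    spans-Ie : Spans I e
    spans-Ie = ≤⇒spans subIe (begin
      r (I ∪ ⁅ e ⁆) ≤⟨ rank-mono subSe (∪⁅⁆-mono I⊆S) ⟩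
      r (S ∪ ⁅ e ⁆) ≡⟨ trans spans-e (sym rI≡rS) ⟩
      r I           ∎)

  nullity : Subset n → ℕ
  nullity X = ∣ X ∣ ℕ.∸ r X

  nullity-⊥ : nullity ⊥ ≡ 0
  nullity-⊥ = trans (cong (ℕ._∸ r ⊥) (∣⊥∣≡0 n)) (ℕ.0∸n≡0 (r ⊥))

  nullity-∪⁅⁆-spans : ∀ {X e} → Subtransversal (X ∪ ⁅ e ⁆) → e ∉ X → Spans X e →
                      nullity (X ∪ ⁅ e ⁆) ≡ suc (nullity X)
  nullity-∪⁅⁆-spans subXe e∉X spans-e = trans (cong₂ ℕ._∸_ (∣p∪⁅x⁆∣≡1+∣p∣ e∉X) spans-e)
    (ℕ.+-∸-assoc 1 (rank≤card (subtransversal-⊆ (p⊆p∪q _) subXe)))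

  nullity-∪⁅⁆-¬spans : ∀ {X e} → Subtransversal (X ∪ ⁅ e ⁆) → e ∉ X → ¬ Spans X e →
                       nullity (X ∪ ⁅ e ⁆) ≡ nullity X
  nullity-∪⁅⁆-¬spans subXe e∉X ¬spans-e =
    cong₂ ℕ._∸_ (∣p∪⁅x⁆∣≡1+∣p∣ e∉X) (¬spans⇒rank-suc subXe ¬spans-e)

module Activity {n m : ℕ} (Z : Multimatroid n m)
                (_≺_ : Rel (Fin m) 0ℓ) (sto : IsStrictTotalOrder _≡_ _≺_) where
  open ≡ using (refl; sym; trans; cong; subst; subst₂)
  open Multimatroid Z
  open MultimatroidRank Z
  open IsStrictTotalOrder sto using (_<?_; irrefl) renaming (trans to ≺-trans)

  Choice : Set
  Choice = Vec (Fin n) m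

  restrict : Choice → {P : Pred (Fin m) 0ℓ} → Decidable P → Subset n
  restrict τ P? = ⟦ (λ u → (lookup τ (cls u) ≟ u) ×-dec P? (cls u)) ⟧

  module _ (τ : Choice) {P : Pred (Fin m) 0ℓ} (P? : Decidable P) where

    ∈restrict⁺ : ∀ {u} → lookup τ (cls u) ≡ u → P (cls u) → u ∈ restrict τ P?
    ∈restrict⁺ τu≡u Pu = ∈⟦⟧⁺ (λ u → (lookup τ (cls u) ≟ u) ×-dec P? (cls u)) (τu≡u , Pu)

    ∈restrict⁻ : ∀ {u} → u ∈ restrict τ P? → lookup τ (cls u) ≡ u × P (cls u)
    ∈restrict⁻ = ∈⟦⟧⁻ (λ u → (lookup τ (cls u) ≟ u) ×-dec P? (cls u))

    restrict-subtransversal : Subtransversal (restrict τ P?)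
    restrict-subtransversal x y x∈ y∈ cx≡cy =
      trans (sym (proj₁ (∈restrict⁻ x∈))) (trans (cong (lookup τ) cx≡cy) (proj₁ (∈restrict⁻ y∈)))

    restrict-avoids : ∀ {ω} → ¬ P ω → Avoids (restrict τ P?) ω
    restrict-avoids ¬Pω z z∈ refl = ¬Pω (proj₂ (∈restrict⁻ z∈))

    ∉restrict : ∀ {k} → cls (lookup τ k) ≡ k → ¬ P k → lookup τ k ∉ restrict τ P?
    ∉restrict cτk≡k ¬Pk τk∈ = restrict-avoids ¬Pk _ τk∈ cτk≡k

  restrict-⊆ : ∀ τ {P Q : Pred (Fin m) 0ℓ} (P? : Decidable P) (Q? : Decidable Q) →
               (∀ κ → P κ → Q κ) → restrict τ P? ⊆ restrict τ Q?
  restrict-⊆ τ P? Q? P⇒Q u∈ with ∈restrict⁻ τ P? u∈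
  ... | τu≡u , Pu = ∈restrict⁺ τ Q? τu≡u (P⇒Q _ Pu)

  restrict-agree : ∀ τ τ′ {P : Pred (Fin m) 0ℓ} (P? : Decidable P) →
                   (∀ κ → P κ → lookup τ κ ≡ lookup τ′ κ) → restrict τ P? ≡ restrict τ′ P?
  restrict-agree τ τ′ {P} P? agree = ⊆-antisym (move τ τ′ agree) (move τ′ τ λ κ Pκ → sym (agree κ Pκ))
    where
    move : ∀ σ σ′ → (∀ κ → P κ → lookup σ κ ≡ lookup σ′ κ) → restrict σ P? ⊆ restrict σ′ P?
    move σ σ′ agree′ u∈ with ∈restrict⁻ σ P? u∈
    ... | σu≡u , Pu = ∈restrict⁺ σ′ P? (trans (sym (agree′ _ Pu)) σu≡u) Pu

  restrict-∪⁅⁆ : ∀ τ {P Q : Pred (Fin m) 0ℓ} (P? : Decidable P) (Q? : Decidable Q) {k} →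
                 cls (lookup τ k) ≡ k → P k → (∀ κ → P κ → Q κ ⊎ κ ≡ k) → (∀ κ → Q κ → P κ) →
                 restrict τ P? ≡ restrict τ Q? ∪ ⁅ lookup τ k ⁆
  restrict-∪⁅⁆ τ {P} P? Q? {k} cτk≡k Pk P⇒Q∨k Q⇒P = ⊆-antisym ⊆∪ ∪⊆
    where
    ⊆∪ : restrict τ P? ⊆ restrict τ Q? ∪ ⁅ lookup τ k ⁆
    ⊆∪ u∈ with ∈restrict⁻ τ P? u∈
    ... | τu≡u , Pu with P⇒Q∨k _ Pu
    ...   | inj₁ Qu   = p⊆p∪q _ (∈restrict⁺ τ Q? τu≡u Qu)
    ...   | inj₂ cu≡k = subst (_∈ _) (trans (cong (lookup τ) (sym cu≡k)) τu≡u) x∈p∪⁅x⁆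
    ∪⊆ : restrict τ Q? ∪ ⁅ lookup τ k ⁆ ⊆ restrict τ P?
    ∪⊆ = p∪⁅x⁆⊆q (restrict-⊆ τ Q? P? Q⇒P)
                 (∈restrict⁺ τ P? (cong (lookup τ) cτk≡k) (subst P (sym cτk≡k) Pk))

  Above : Choice → Fin m → Subset n
  Above τ ω = restrict τ (ω <?_)

  module _ (τ : Choice) where

    ∈Above⁺ : ∀ {ω u} → lookup τ (cls u) ≡ u → ω ≺ cls u → u ∈ Above τ ω
    ∈Above⁺ {ω} = ∈restrict⁺ τ (ω <?_)

    ∈Above⁻ : ∀ {ω u} → u ∈ Above τ ω → lookup τ (cls u) ≡ u × ω ≺ cls u
    ∈Above⁻ {ω} = ∈restrict⁻ τ (ω <?_)

    ∈toSubset⁺ : ∀ {u} → lookup τ (cls u) ≡ u → u ∈ toSubset Z _≺_ τ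
    ∈toSubset⁺ = ∈⟦⟧⁺ (λ u → lookup τ (cls u) ≟ u)

    ∈toSubset⁻ : ∀ {u} → u ∈ toSubset Z _≺_ τ → lookup τ (cls u) ≡ u
    ∈toSubset⁻ = ∈⟦⟧⁻ (λ u → lookup τ (cls u) ≟ u)

    Above⊆toSubset : ∀ {ω} → Above τ ω ⊆ toSubset Z _≺_ τ
    Above⊆toSubset u∈ = ∈toSubset⁺ (proj₁ (∈Above⁻ u∈))

    Above-subtransversal : ∀ {ω} → Subtransversal (Above τ ω)
    Above-subtransversal {ω} = restrict-subtransversal τ (ω <?_)

    Above-avoids : ∀ {ω} → Avoids (Above τ ω) ω
    Above-avoids {ω} = restrict-avoids τ (ω <?_) (irrefl refl)

    Above∪⁅⁆-subtransversal : ∀ {ω e} → cls e ≡ ω → Subtransversal (Above τ ω ∪ ⁅ e ⁆)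
    Above∪⁅⁆-subtransversal refl = subtransversal-∪⁅⁆ Above-subtransversal Above-avoids

    ∉Above : ∀ {ω e} → cls e ≡ ω → e ∉ Above τ ω
    ∉Above ce≡ω e∈ = Above-avoids _ e∈ ce≡ω

    circuit⇒spans-Above : ∀ {C x} → IsCircuit Z C → IsMin Z _≺_ x C →
                          (∀ y → y ∈ C → y ≢ x → lookup τ (cls y) ≡ y) → Spans (Above τ (cls x)) x
    circuit⇒spans-Above {C} {x} circuit (x∈C , x-min) C-x⊆T =
      circuit⇒spans circuit x∈C C-x⊆Above (Above∪⁅⁆-subtransversal refl)
      where
      C-x⊆Above : C - x ⊆ Above τ (cls x)
      C-x⊆Above y∈ = ∈Above⁺ (C-x⊆T _ (p─q⊆p C ⁅ x ⁆ y∈) (x∈p-y⇒x≢y y∈))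
                                    (x-min _ (p─q⊆p C ⁅ x ⁆ y∈) (x∈p-y⇒x≢y y∈))

    spans-Above⇒circuit : ∀ {ω e} → cls e ≡ ω → Spans (Above τ ω) e →
                          ∃ λ C → IsCircuit Z C × IsMin Z _≺_ e C × (∀ y → y ∈ C → y ≢ e → y ∈ Above τ ω)
    spans-Above⇒circuit {ω} {e} ce≡ω spans with spans⇒circuit (Above∪⁅⁆-subtransversal ce≡ω) (∉Above ce≡ω) spans
    ... | C , circuit , e∈C , C⊆ = C , circuit , (e∈C , e-min) , above
      where
      above : ∀ y → y ∈ C → y ≢ e → y ∈ Above τ ω
      above y y∈C y≢e = [ id , (λ y≡e → ⊥-elim (y≢e y≡e)) ]′ (x∈p∪⁅y⁆⁻ (C⊆ y∈C))
      e-min : ∀ y → y ∈ C → y ≢ e → cls e ≺ cls y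
      e-min y y∈C y≢e = subst (_≺ cls y) (sym ce≡ω) (proj₂ (∈Above⁻ (above y y∈C y≢e)))

  Live : Fin m → Subset n → Set
  Live ω S = ∃ λ e → cls e ≡ ω × Spans S e

  live? : ∀ ω S → Dec (Live ω S)
  live? ω S = any? λ e → (cls e ≟ ω) ×-dec spans? S e

  Good : Fin m → Subset n → Fin n → Set
  Good ω S c = ∀ e → cls e ≡ ω → Spans S e → e ≡ c

  good? : ∀ ω S c → Dec (Good ω S c)
  good? ω S c = all? λ e → (cls e ≟ ω) →-dec (spans? S e →-dec (e ≟ c))

  active⇔live : ∀ τ ω → Active Z _≺_ (toSubset Z _≺_ τ) ω ⇔ Live ω (Above τ ω)
  active⇔live τ ω = mk⇔ to from
    where
    to : Active Z _≺_ (toSubset Z _≺_ τ) ω → Live ω (Above τ ω)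
    to (C , x , circuit , x-min , refl , rest) =
      x , refl , circuit⇒spans-Above τ circuit x-min λ y y∈C y≢x →
        ∈toSubset⁻ τ (rest y y∈C λ cy≡cx → irrefl (sym cy≡cx) (proj₂ x-min y y∈C y≢x))
    from : Live ω (Above τ ω) → Active Z _≺_ (toSubset Z _≺_ τ) ω
    from (e , ce≡ω , spans) with spans-Above⇒circuit τ ce≡ω spans
    ... | C , circuit , e-min , above = C , e , circuit , e-min , ce≡ω ,
          λ y y∈C cy≢ω → Above⊆toSubset τ (above y y∈C λ { refl → cy≢ω ce≡ω })

  cocompatible⇔good : ∀ τ → Cocompatible Z _≺_ (toSubset Z _≺_ τ) ⇔ (∀ ω → Good ω (Above τ ω) (lookup τ ω))
  cocompatible⇔good τ = mk⇔ to from
    where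
    to : Cocompatible Z _≺_ (toSubset Z _≺_ τ) → ∀ ω → Good ω (Above τ ω) (lookup τ ω)
    to cocompatible ω e ce≡ω spans = decidable-stable (e ≟ lookup τ ω) λ e≢τω →
      let C , circuit , e-min , above = spans-Above⇒circuit τ ce≡ω spans
      in cocompatible (C , e , circuit , e-min ,
                       (λ e∈T → e≢τω (sym (trans (cong (lookup τ) (sym ce≡ω)) (∈toSubset⁻ τ e∈T)))) ,
                       λ y y∈C y≢e → Above⊆toSubset τ (above y y∈C y≢e))
    from : (∀ ω → Good ω (Above τ ω) (lookup τ ω)) → Cocompatible Z _≺_ (toSubset Z _≺_ τ)
    from good (C , x , circuit , x-min , x∉T , rest) =
      x∉T (∈toSubset⁺ τ (sym (good (cls x) x refl
        (circuit⇒spans-Above τ circuit x-min λ y y∈C y≢x → ∈toSubset⁻ τ (rest y y∈C y≢x)))))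

  between? : ∀ ω k κ → Dec (ω ≺ κ × κ ≢ k)
  between? ω k κ = (ω <? κ) ×-dec ¬? (κ ≟ k)

  Above∖ : Choice → Fin m → Fin m → Subset n
  Above∖ τ ω k = restrict τ (between? ω k)

  Above-split : ∀ τ {ω k} → cls (lookup τ k) ≡ k → ω ≺ k → Above τ ω ≡ Above∖ τ ω k ∪ ⁅ lookup τ k ⁆
  Above-split τ {ω} {k} cτk≡k ω≺k = restrict-∪⁅⁆ τ (ω <?_) (between? ω k) cτk≡k ω≺k split (λ _ → proj₁)
    where
    split : ∀ κ → ω ≺ κ → (ω ≺ κ × κ ≢ k) ⊎ κ ≡ k
    split κ ω≺κ with κ ≟ k
    ... | yes κ≡k = inj₂ κ≡k
    ... | no κ≢k  = inj₁ (ω≺κ , κ≢k)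

  SameSpan : Fin m → Subset n → Subset n → Set
  SameSpan ω S S′ = ∀ e → cls e ≡ ω → Spans S e ⇔ Spans S′ e

  module _ (τ τ′ : Choice) {k : Fin m} (agree : ∀ κ → κ ≢ k → lookup τ κ ≡ lookup τ′ κ) where

    Above-agree : ∀ {ω} → ¬ ω ≺ k → Above τ ω ≡ Above τ′ ω
    Above-agree {ω} ω⊀k = restrict-agree τ τ′ (ω <?_) λ κ ω≺κ → agree κ (κ≢k ω≺κ)
      where
      κ≢k : ∀ {κ} → ω ≺ κ → κ ≢ k
      κ≢k ω≺κ refl = ω⊀k ω≺κ

    Above∖-agree : ∀ {ω} → Above∖ τ ω k ≡ Above∖ τ′ ω k
    Above∖-agree {ω} = restrict-agree τ τ′ (between? ω k) λ κ (_ , κ≢k) → agree κ κ≢k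

    Above-swap : IsChoice Z _≺_ τ → IsChoice Z _≺_ τ′ → Spans (Above τ k) (lookup τ k) →
                 ∀ ω → SameSpan ω (Above τ ω) (Above τ′ ω)
    Above-swap choice choice′ spans-k ω e ce≡ω with ω <? k
    ... | no ω⊀k = subst (λ S → Spans (Above τ ω) e ⇔ Spans S e) (Above-agree ω⊀k) (mk⇔ id id)
    ... | yes ω≺k = subst₂ (λ S S′ → Spans S e ⇔ Spans S′ e) (sym (Above-split τ (choice k) ω≺k)) (sym split′)
      (spans-swap (restrict-subtransversal τ (between? ω k)) avoids-k avoids-e
                  (trans (choice k) (sym (choice′ k))) ce≢cτk spans-k′)
      where
      split′ : Above τ′ ω ≡ Above∖ τ ω k ∪ ⁅ lookup τ′ k ⁆
      split′ = trans (Above-split τ′ (choice′ k) ω≺k) (cong (_∪ ⁅ lookup τ′ k ⁆) (sym Above∖-agree))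
      ce≢cτk : cls e ≢ cls (lookup τ k)
      ce≢cτk ce≡cτk = irrefl refl (subst (_≺ k) (trans (sym ce≡ω) (trans ce≡cτk (choice k))) ω≺k)
      avoids-k : Avoids (Above∖ τ ω k) (cls (lookup τ k))
      avoids-k = subst (Avoids (Above∖ τ ω k)) (sym (choice k))
                       (restrict-avoids τ (between? ω k) λ (_ , k≢k) → k≢k refl)
      avoids-e : Avoids (Above∖ τ ω k) (cls e)
      avoids-e = subst (Avoids (Above∖ τ ω k)) (sym ce≡ω)
                       (restrict-avoids τ (between? ω k) λ (ω≺ω , _) → irrefl refl ω≺ω)
      k≺⇒between : ∀ κ → k ≺ κ → ω ≺ κ × κ ≢ k
      k≺⇒between κ k≺κ = ≺-trans ω≺k k≺κ , λ { refl → irrefl refl k≺κ }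
      spans-k′ : Spans (Above∖ τ ω k) (lookup τ k)
      spans-k′ = spans-mono (restrict-⊆ τ (k <?_) (between? ω k) k≺⇒between)
                            (subst Subtransversal (Above-split τ (choice k) ω≺k) (Above-subtransversal τ))
                            spans-k

module Expansion {c ℓ} (R : CommutativeSemiring c ℓ) {n m : ℕ} (Z : Multimatroid n m)
                 (_≺_ : Rel (Fin m) 0ℓ) (sto : IsStrictTotalOrder _≡_ _≺_)
                 (x : Fin n → CommutativeSemiring.Carrier R) (t : CommutativeSemiring.Carrier R) where
  open CommutativeSemiring R hiding (zero)
  open Sums R
  open SemiringSums R
  open Multimatroid Z
  open MultimatroidRank Z
  open Activity Z _≺_ sto
  open Least sto
  open import Algebra.Properties.Semiring.Sum semiring using (*-distribʳ-sum)
  open import Relation.Binary.Reasoning.Setoid setoid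

  _^ᵇ_ : Carrier → Bool → Carrier
  a ^ᵇ b = if b then a else 1#

  weight : Subset n → Fin n → Carrier
  weight S e = x e * t ^ᵇ does (spans? S e)

  spread : Fin m → Subset n → Carrier
  spread ω S = ∑ λ e → if does (cls e ≟ ω) then weight S e else 0#

  settled : Fin m → Subset n → Fin n → Carrier
  settled ω S c = if does (good? ω S c) then (if does (live? ω S) then spread ω S else weight S c) else 0#

  module _ {ω : Fin m} {S S′ : Subset n} (same : SameSpan ω S S′) where

    weight-cong : ∀ {e} → cls e ≡ ω → weight S e ≡ weight S′ e
    weight-cong {e} ce≡ω = ≡.cong (λ b → x e * t ^ᵇ b) (does-⇔ (same e ce≡ω) (spans? S e) (spans? S′ e))

    settled-cong : ∀ c → cls c ≡ ω → settled ω S c ≈ settled ω S′ c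
    settled-cong c cc≡ω = begin
      settled ω S c
        ≡⟨ ≡.cong₂ (λ g l → if g then (if l then spread ω S else weight S c) else 0#)
             (does-⇔ good⇔ (good? ω S c) (good? ω S′ c)) (does-⇔ live⇔ (live? ω S) (live? ω S′)) ⟩
      (if does (good? ω S′ c) then (if does (live? ω S′) then spread ω S else weight S c) else 0#)
        ≈⟨ if-cong (does (good? ω S′ c))
             (if-cong (does (live? ω S′)) spread≈ (reflexive (weight-cong cc≡ω))) refl ⟩
      settled ω S′ c ∎
      where
      open Equivalence
      good⇔ : Good ω S c ⇔ Good ω S′ c
      good⇔ = Function.mk⇔ (λ g e ce≡ω → g e ce≡ω ∘ from (same e ce≡ω)) (λ g e ce≡ω → g e ce≡ω ∘ to (same e ce≡ω))
      live⇔ : Live ω S ⇔ Live ω S′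
      live⇔ = Function.mk⇔ (λ (e , ce≡ω , sp) → e , ce≡ω , to (same e ce≡ω) sp)
                           (λ (e , ce≡ω , sp) → e , ce≡ω , from (same e ce≡ω) sp)
      spread≈ : spread ω S ≈ spread ω S′
      spread≈ = Sum.sum-cong-≋ λ e → term≈ e (cls e ≟ ω)
        where
        term≈ : ∀ e (d : Dec (cls e ≡ ω)) →
                (if does d then weight S e else 0#) ≈ (if does d then weight S′ e else 0#)
        term≈ e (yes ce≡ω) = reflexive (weight-cong ce≡ω)
        term≈ e (no _)     = refl

  settled-dead : ∀ {ω S c} → ¬ Live ω S → settled ω S c ≈ weight S c
  settled-dead {ω} {S} {c} dead
    rewrite dec-true (good? ω S c) (λ e ce≡ω sp → ⊥-elim (dead (e , ce≡ω , sp)))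
          | dec-false (live? ω S) dead = refl

  settled-bad : ∀ {ω S c} → ¬ Good ω S c → settled ω S c ≈ 0#
  settled-bad {ω} {S} {c} bad rewrite dec-false (good? ω S c) bad = refl

  settled-live : ∀ {ω S c} → Good ω S c → Live ω S → settled ω S c ≈ spread ω S
  settled-live {ω} {S} {c} good live rewrite dec-true (good? ω S c) good | dec-true (live? ω S) live = refl

  factor : (Fin m → Bool) → Choice → Fin m → Carrier
  factor done τ ω = if done ω then settled ω (Above τ ω) (lookup τ ω) else weight (Above τ ω) (lookup τ ω)

  factor-cong : ∀ done τ τ′ {ω} → SameSpan ω (Above τ ω) (Above τ′ ω) → lookup τ ω ≡ lookup τ′ ω →
                cls (lookup τ ω) ≡ ω → factor done τ ω ≈ factor done τ′ ω
  factor-cong done τ τ′ {ω} same τω≡τ′ω cτω≡ω = if-cong (done ω)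
    (trans (settled-cong same _ cτω≡ω) (reflexive (≡.cong (settled ω (Above τ′ ω)) τω≡τ′ω)))
    (reflexive (≡.trans (weight-cong same cτω≡ω) (≡.cong (weight (Above τ′ ω)) τω≡τ′ω)))

  choice? : ∀ τ → Dec (IsChoice Z _≺_ τ)
  choice? τ = all? λ ω → cls (lookup τ ω) ≟ ω

  summand : (Fin m → Bool) → Choice → Carrier
  summand done τ = if does (choice? τ) then ∏ (factor done τ) else 0#

  total : (Fin m → Bool) → Carrier
  total done = ΣL (allVecs n m) (summand done)

  summand-choice : ∀ done τ → IsChoice Z _≺_ τ → summand done τ ≈ ∏ (factor done τ)
  summand-choice done τ choice = if-dec (choice? τ) (λ _ → refl) (λ ¬choice → ⊥-elim (¬choice choice))

  summand-¬choice : ∀ done τ → ¬ IsChoice Z _≺_ τ → summand done τ ≈ 0#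
  summand-¬choice done τ ¬choice = if-dec (choice? τ) (λ choice → ⊥-elim (¬choice choice)) (λ _ → refl)

  module Fibre (done done′ : Fin m → Bool) (k : Fin m) (done≡done′ : ∀ ω → ω ≢ k → done ω ≡ done′ ω)
               (k-todo : done k ≡ false) (k-done : done′ k ≡ true) (v : Vec (Fin n) (ℕ.pred m)) where
    open IsStrictTotalOrder sto using (irrefl)

    τ : Fin n → Choice
    τ e = insert v k e

    agree : ∀ e e′ κ → κ ≢ k → lookup (τ e) κ ≡ lookup (τ e′) κ
    agree e e′ κ = insert-lookup-≢ v e e′

    Above-k : ∀ e e′ → Above (τ e) k ≡ Above (τ e′) k
    Above-k e e′ = Above-agree (τ e) (τ e′) (agree e e′) (irrefl ≡.refl)

    choice-at : ∀ e e′ → IsChoice Z _≺_ (τ e′) → cls e ≡ k → IsChoice Z _≺_ (τ e)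
    choice-at e e′ choice ce≡k κ with κ ≟ k
    ... | yes ≡.refl = ≡.trans (≡.cong cls (insert-lookup v k e)) ce≡k
    ... | no κ≢k     = ≡.trans (≡.cong cls (agree e e′ κ κ≢k)) (choice κ)

    ¬choice-at : ∀ e → cls e ≢ k → ¬ IsChoice Z _≺_ (τ e)
    ¬choice-at e ce≢k choice = ce≢k (≡.trans (≡.cong cls (≡.sym (insert-lookup v k e))) (choice k))

    factor-off-k : ∀ σ ω → ω ≢ k → factor done σ ω ≡ factor done′ σ ω
    factor-off-k σ ω ω≢k = ≡.cong (λ b → if b then _ else _) (done≡done′ ω ω≢k)

    factor-k : ∀ e → factor done (τ e) k ≡ weight (Above (τ e) k) e
    factor-k e rewrite k-todo | insert-lookup v k e = ≡.refl

    factor′-k : ∀ e → factor done′ (τ e) k ≡ settled k (Above (τ e) k) e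
    factor′-k e rewrite k-done | insert-lookup v k e = ≡.refl

    Dead : Set
    Dead = ¬ (∃ λ d → cls d ≡ k × Spans (Above (τ d) k) d)

    fibre-dead : Dead → ∀ e → summand done (τ e) ≈ summand done′ (τ e)
    fibre-dead dead e = if-cong (does (choice? (τ e))) (Prod.sum-cong-≋ factor≈) refl
      where
      dead-e : ¬ Live k (Above (τ e) k)
      dead-e (d , cd≡k , spans) = dead (d , cd≡k , ≡.subst (λ S → Spans S d) (Above-k e d) spans)
      factor≈ : ∀ ω → factor done (τ e) ω ≈ factor done′ (τ e) ω
      factor≈ ω with ω ≟ k
      ... | no ω≢k     = reflexive (factor-off-k (τ e) ω ω≢k)
      ... | yes ≡.refl = begin
        factor done (τ e) ω          ≡⟨ factor-k e ⟩
        weight (Above (τ e) ω) e     ≈⟨ settled-dead dead-e ⟨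
        settled ω (Above (τ e) ω) e  ≡⟨ factor′-k e ⟨
        factor done′ (τ e) ω         ∎

    module LiveFibre (d : Fin n) (cd≡k : cls d ≡ k) (spans-d : Spans (Above (τ d) k) d) where

      S : Subset n
      S = Above (τ d) k

      good-d : Good k S d
      good-d e ce≡k spans-e = decidable-stable (e ≟ d) λ e≢d →
        skew-not-both (Above-subtransversal (τ d)) (≡.subst (Avoids S) (≡.sym cd≡k) (Above-avoids (τ d)))
                      (e≢d ∘ ≡.sym) (≡.trans cd≡k (≡.sym ce≡k)) spans-d spans-e

      rest : Carrier
      rest = ∏ λ ω → if does (ω ≟ k) then 1# else factor done (τ d) ω

      summand-after-≢d : ∀ e → e ≢ d → summand done′ (τ e) ≈ 0#
      summand-after-≢d e e≢d = if-dec (choice? (τ e))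
        (λ _ → ∏-zero _ k (trans (reflexive (factor′-k e)) (settled-bad ¬good))) (λ _ → refl)
        where
        ¬good : ¬ Good k (Above (τ e) k) e
        ¬good good = e≢d (≡.sym (good d cd≡k (≡.subst (λ S → Spans S d) (Above-k d e) spans-d)))

      module _ (choice : IsChoice Z _≺_ (τ d)) where

        summand-before : ∀ e → summand done (τ e) ≈ (if does (cls e ≟ k) then weight S e else 0#) * rest
        summand-before e with cls e ≟ k
        ... | no ce≢k  = trans (summand-¬choice done (τ e) (¬choice-at e ce≢k)) (sym (zeroˡ rest))
        ... | yes ce≡k = begin
          summand done (τ e)          ≈⟨ summand-choice done (τ e) (choice-at e d choice ce≡k) ⟩
          ∏ (factor done (τ e))       ≈⟨ Prod.sum-extract _ (factor done (τ d)) k swap ⟩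
          factor done (τ e) k * rest
            ≡⟨ ≡.cong (_* rest) (≡.trans (factor-k e) (≡.cong (λ S → weight S e) (Above-k e d))) ⟩
          weight S e * rest           ∎
          where
          spans-τk : Spans S (lookup (τ d) k)
          spans-τk = ≡.subst (Spans S) (≡.sym (insert-lookup v k d)) spans-d
          swap : ∀ ω → ω ≢ k → factor done (τ e) ω ≈ factor done (τ d) ω
          swap ω ω≢k = sym (factor-cong done (τ d) (τ e)
            (Above-swap (τ d) (τ e) (agree d e) choice (choice-at e d choice ce≡k) spans-τk ω)
            (agree d e ω ω≢k) (choice ω))

        summand-after : summand done′ (τ d) ≈ spread k S * rest
        summand-after = begin
          summand done′ (τ d)
            ≈⟨ summand-choice done′ (τ d) choice ⟩
          ∏ (factor done′ (τ d))
            ≈⟨ Prod.sum-extract _ (factor done (τ d)) k (λ ω ω≢k → reflexive (≡.sym (factor-off-k (τ d) ω ω≢k))) ⟩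
          factor done′ (τ d) k * rest
            ≈⟨ *-congʳ (trans (reflexive (factor′-k d)) (settled-live good-d (d , cd≡k , spans-d))) ⟩
          spread k S * rest ∎

      fibre-live : ∑ (λ e → summand done (τ e)) ≈ ∑ (λ e → summand done′ (τ e))
      fibre-live with choice? (τ d)
      ... | no ¬choice = trans (Sum.sum-zero (zero-summand done)) (sym (Sum.sum-zero (zero-summand done′)))
        where
        zero-summand : ∀ done e → summand done (τ e) ≈ 0#
        zero-summand done e = summand-¬choice done (τ e) λ choice → ¬choice (choice-at d e choice cd≡k)
      ... | yes choice = begin
        ∑ (λ e → summand done (τ e))   ≈⟨ Sum.sum-cong-≋ (summand-before choice) ⟩
        ∑ (λ e → term e * rest)        ≈⟨ *-distribʳ-sum rest term ⟨
        spread k S * rest              ≈⟨ summand-after choice ⟨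
        summand done′ (τ d)            ≈⟨ Sum.sum-single _ d summand-after-≢d ⟨
        ∑ (λ e → summand done′ (τ e))  ∎
        where
        term : Fin n → Carrier
        term e = if does (cls e ≟ k) then weight S e else 0#

    fibre : ∑ (λ e → summand done (τ e)) ≈ ∑ (λ e → summand done′ (τ e))
    fibre with any? (λ d → (cls d ≟ k) ×-dec spans? (Above (τ d) k) d)
    ... | no dead                  = Sum.sum-cong-≋ (fibre-dead dead)
    ... | yes (d , cd≡k , spans-d) = LiveFibre.fibre-live d cd≡k spans-d

  step : ∀ done done′ k → (∀ ω → ω ≢ k → done ω ≡ done′ ω) → done k ≡ false → done′ k ≡ true →
         total done ≈ total done′
  step done done′ k done≡done′ k-todo k-done = begin
    total done
      ≈⟨ ΣL-allVecs-insert k (summand done) ⟩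
    ΣL (allVecs n (ℕ.pred m)) (λ v → ∑ (λ e → summand done (insert v k e)))
      ≈⟨ ΣL-cong (allVecs n (ℕ.pred m)) (Fibre.fibre done done′ k done≡done′ k-todo k-done) ⟩
    ΣL (allVecs n (ℕ.pred m)) (λ v → ∑ (λ e → summand done′ (insert v k e)))
      ≈⟨ ΣL-allVecs-insert k (summand done′) ⟨
    total done′ ∎

  total-cong : ∀ {done done′} → (∀ ω → done ω ≡ done′ ω) → total done ≈ total done′
  total-cong done≡done′ = ΣL-cong (allVecs n m) λ τ → if-cong (does (choice? τ))
    (Prod.sum-cong-≋ λ ω → reflexive (≡.cong (λ b → if b then _ else _) (done≡done′ ω))) refl

  -- Classes are processed in the order of their indices, which has nothing to do with ≺.
  processedBefore : ℕ → Fin m → Bool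
  processedBefore j ω = does (toℕ ω ℕ.<? j)

  telescope : ∀ j → j ℕ.≤ m → total (processedBefore 0) ≈ total (processedBefore j)
  telescope zero    _   = refl
  telescope (suc j) j<m = trans (telescope j (ℕ.<⇒≤ j<m))
    (step (processedBefore j) (processedBefore (suc j)) k same-off-k
          (dec-false (toℕ k ℕ.<? j) (ℕ.<-irrefl k≡j))
          (dec-true (toℕ k ℕ.<? suc j) (ℕ.≤-reflexive (≡.cong suc k≡j))))
    where
    k = fromℕ< j<m
    k≡j : toℕ k ≡ j
    k≡j = toℕ-fromℕ< j<m
    same-off-k : ∀ ω → ω ≢ k → processedBefore j ω ≡ processedBefore (suc j) ω
    same-off-k ω ω≢k = does-⇔ (mk⇔ ℕ.m<n⇒m<1+n λ ω<1+j →
        ℕ.≤∧≢⇒< (ℕ.≤-pred ω<1+j) λ ω≡j → ω≢k (toℕ-injective (≡.trans ω≡j (≡.sym k≡j))))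
      (toℕ ω ℕ.<? j) (toℕ ω ℕ.<? suc j)

  unprocessed≈processed : total (λ _ → false) ≈ total (λ _ → true)
  unprocessed≈processed = begin
    total (λ _ → false)          ≈⟨ total-cong (λ ω → ≡.sym (dec-false (toℕ ω ℕ.<? 0) λ ())) ⟩
    total (processedBefore 0)    ≈⟨ telescope m ℕ.≤-refl ⟩
    total (processedBefore m)    ≈⟨ total-cong (λ ω → dec-true (toℕ ω ℕ.<? m) (toℕ<n ω)) ⟩
    total (λ _ → true)           ∎

  pow-nullity-∪⁅⁆ : ∀ {X e} → Subtransversal (X ∪ ⁅ e ⁆) → e ∉ X →
                    pow t (nullity (X ∪ ⁅ e ⁆)) ≈ t ^ᵇ does (spans? X e) * pow t (nullity X)
  pow-nullity-∪⁅⁆ {X} {e} subXe e∉X with spans? X e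
  ... | yes spans = begin
    pow t (nullity (X ∪ ⁅ e ⁆))         ≡⟨ ≡.cong (pow t) (nullity-∪⁅⁆-spans subXe e∉X spans) ⟩
    t * pow t (nullity X)               ≡⟨ ≡.cong (λ b → t ^ᵇ b * pow t (nullity X)) (dec-true (spans? X e) spans) ⟨
    t ^ᵇ does (spans? X e) * pow t (nullity X) ∎
  ... | no ¬spans = begin
    pow t (nullity (X ∪ ⁅ e ⁆))         ≡⟨ ≡.cong (pow t) (nullity-∪⁅⁆-¬spans subXe e∉X ¬spans) ⟩
    pow t (nullity X)                   ≈⟨ *-identityˡ _ ⟨
    1# * pow t (nullity X)              ≡⟨ ≡.cong (λ b → t ^ᵇ b * pow t (nullity X)) (dec-false (spans? X e) ¬spans) ⟨
    t ^ᵇ does (spans? X e) * pow t (nullity X) ∎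

  UpSet : Subset m → Set
  UpSet A = ∀ {ω ω′} → ω ∈ A → ω ≺ ω′ → ω′ ∈ A

  UpSet-remove-least : ∀ {A μ} → UpSet A → IsLeast μ A → UpSet (A - μ)
  UpSet-remove-least {A} {μ} up (_ , μ-least) {ω} ω∈A-μ ω≺ω′ =
    x∈p∧x≢y⇒x∈p-y (up ω∈A ω≺ω′) λ { ≡.refl → asym ω≺ω′ (μ-least ω ω∈A (x∈p-y⇒x≢y ω∈A-μ)) }
    where
    open IsStrictTotalOrder sto using (asym)
    ω∈A = p─q⊆p A ⁅ μ ⁆ ω∈A-μ

  module _ (τ : Choice) (choice : IsChoice Z _≺_ τ) where
    open IsStrictTotalOrder sto using (_<?_; irrefl)
    open import Algebra.Properties.CommutativeSemigroup *-commutativeSemigroup using (interchange)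

    T : Subset n
    T = toSubset Z _≺_ τ

    T↾ : Subset m → Subset n
    T↾ A = restrict τ (_∈? A)

    T↾-split : ∀ {A μ} → μ ∈ A → T↾ A ≡ T↾ (A - μ) ∪ ⁅ lookup τ μ ⁆
    T↾-split {A} {μ} μ∈A = restrict-∪⁅⁆ τ (_∈? A) (_∈? (A - μ)) (choice μ) μ∈A split (λ κ → p─q⊆p A ⁅ μ ⁆)
      where
      split : ∀ κ → κ ∈ A → κ ∈ A - μ ⊎ κ ≡ μ
      split κ κ∈A with κ ≟ μ
      ... | yes κ≡μ = inj₂ κ≡μ
      ... | no κ≢μ  = inj₁ (x∈p∧x≢y⇒x∈p-y κ∈A κ≢μ)

    T↾-remove-least : ∀ {A μ} → UpSet A → IsLeast μ A → T↾ (A - μ) ≡ Above τ μ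
    T↾-remove-least {A} {μ} up (μ∈A , μ-least) = ⊆-antisym
      (restrict-⊆ τ (_∈? (A - μ)) (μ <?_) λ κ κ∈A-μ → μ-least κ (p─q⊆p A ⁅ μ ⁆ κ∈A-μ) (x∈p-y⇒x≢y κ∈A-μ))
      (restrict-⊆ τ (μ <?_) (_∈? (A - μ)) λ κ μ≺κ → x∈p∧x≢y⇒x∈p-y (up μ∈A μ≺κ) λ { ≡.refl → irrefl ≡.refl μ≺κ })

    qFactor : Fin m → Carrier
    qFactor ω = weight (Above τ ω) (lookup τ ω)

    upset-expansion : ∀ A → Acc _⊂_ A → UpSet A →
                      pow t (nullity (T↾ A)) * Prod.sum∈ (T↾ A) x ≈ Prod.sum∈ A qFactor
    upset-expansion A (acc rs) up with nonempty? A
    ... | no empty = begin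
      pow t (nullity (T↾ A)) * Prod.sum∈ (T↾ A) x  ≡⟨ ≡.cong (λ X → pow t (nullity X) * Prod.sum∈ X x) T↾A≡⊥ ⟩
      pow t (nullity ⊥) * Prod.sum∈ ⊥ x            ≡⟨ ≡.cong (λ k → pow t k * Prod.sum∈ ⊥ x) nullity-⊥ ⟩
      1# * Prod.sum∈ ⊥ x                           ≈⟨ *-identityˡ _ ⟩
      Prod.sum∈ ⊥ x                                ≈⟨ Prod.sum∈-⊥ x ⟩
      1#                                           ≈⟨ Prod.sum∈-⊥ qFactor ⟨
      Prod.sum∈ ⊥ qFactor                          ≡⟨ ≡.cong (λ B → Prod.sum∈ B qFactor) (Empty-unique empty) ⟨
      Prod.sum∈ A qFactor                          ∎
      where
      T↾A≡⊥ : T↾ A ≡ ⊥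
      T↾A≡⊥ = Empty-unique λ (u , u∈) → empty (cls u , proj₂ (∈restrict⁻ τ (_∈? A) u∈))
    ... | yes nonempty with least A (acc rs) nonempty
    ...   | μ , isLeast@(μ∈A , _) = begin
      pow t (nullity (T↾ A)) * Prod.sum∈ (T↾ A) x
        ≡⟨ ≡.cong (λ X → pow t (nullity X) * Prod.sum∈ X x) (T↾-split μ∈A) ⟩
      pow t (nullity (T↾ A′ ∪ ⁅ a ⁆)) * Prod.sum∈ (T↾ A′ ∪ ⁅ a ⁆) x
        ≈⟨ *-cong (pow-nullity-∪⁅⁆ subT↾A a∉T↾A′) (Prod.sum∈-∪⁅⁆ x a∉T↾A′) ⟩
      (t ^ᵇ does (spans? (T↾ A′) a) * pow t (nullity (T↾ A′))) * (x a * Prod.sum∈ (T↾ A′) x)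
        ≈⟨ interchange _ _ _ _ ⟩
      (t ^ᵇ does (spans? (T↾ A′) a) * x a) * (pow t (nullity (T↾ A′)) * Prod.sum∈ (T↾ A′) x)
        ≈⟨ *-cong (*-comm _ _) (upset-expansion A′ (rs (x∈p⇒p-x⊂p μ∈A)) (UpSet-remove-least up isLeast)) ⟩
      weight (T↾ A′) a * Prod.sum∈ A′ qFactor
        ≡⟨ ≡.cong (λ S → weight S a * Prod.sum∈ A′ qFactor) (T↾-remove-least up isLeast) ⟩
      qFactor μ * Prod.sum∈ A′ qFactor
        ≈⟨ Prod.sum∈-∪⁅⁆ qFactor x∉p-x ⟨
      Prod.sum∈ (A′ ∪ ⁅ μ ⁆) qFactor
        ≡⟨ ≡.cong (λ B → Prod.sum∈ B qFactor) (x∈p⇒p-x∪⁅x⁆≡p μ∈A) ⟩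
      Prod.sum∈ A qFactor ∎
      where
      A′ = A - μ
      a = lookup τ μ
      a∉T↾A′ : a ∉ T↾ A′
      a∉T↾A′ = ∉restrict τ (_∈? A′) (choice μ) x∉p-x
      subT↾A : Subtransversal (T↾ A′ ∪ ⁅ a ⁆)
      subT↾A = ≡.subst Subtransversal (T↾-split μ∈A) (restrict-subtransversal τ (_∈? A))

    Q-term≈unprocessed : pow t (nullity T) * ΠF n (λ u → if does (u ∈? T) then x u else 1#) ≈
                         ∏ (factor (λ _ → false) τ)
    Q-term≈unprocessed = begin
      pow t (nullity T) * ΠF n (λ u → if does (u ∈? T) then x u else 1#)
                                                   ≡⟨ ≡.cong (pow t (nullity T) *_) (ΠF≡∏ n _) ⟩
      pow t (nullity T) * Prod.sum∈ T x            ≡⟨ ≡.cong (λ X → pow t (nullity X) * Prod.sum∈ X x) T↾⊤≡T ⟨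
      pow t (nullity (T↾ ⊤)) * Prod.sum∈ (T↾ ⊤) x  ≈⟨ upset-expansion ⊤ (⊂-wellFounded ⊤) (λ _ _ → ∈⊤) ⟩
      Prod.sum∈ ⊤ qFactor                          ≈⟨ Prod.sum∈-⊤ qFactor ⟩
      ∏ qFactor                                    ∎
      where
      T↾⊤≡T : T↾ ⊤ ≡ T
      T↾⊤≡T = ⊆-antisym (λ u∈ → ∈toSubset⁺ τ (proj₁ (∈restrict⁻ τ (_∈? ⊤) u∈)))
                        (λ u∈ → ∈restrict⁺ τ (_∈? ⊤) (∈toSubset⁻ τ u∈) ∈⊤)

  spread-good : ∀ {ω S c} → cls c ≡ ω → Good ω S c → Spans S c →
                spread ω S ≈ ΣF n (λ e → if does (cls e ≟ ω) ∧ not (does (e ≟ c)) then x e else 0#) + t * x c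
  spread-good {ω} {S} {c} cc≡ω good spans-c = begin
    spread ω S            ≈⟨ Sum.sum-cong-≋ split ⟩
    ∑ (λ e → U e + V e)   ≈⟨ Sum.∑-distrib-+ U V ⟩
    ∑ U + ∑ V             ≈⟨ +-cong (reflexive (≡.sym (ΣF≡∑ n U))) (Sum.sum-single V c V-off) ⟩
    ΣF n U + V c          ≡⟨ ≡.cong (λ b → ΣF n U + (if b then t * x c else 0#)) (dec-true (c ≟ c) ≡.refl) ⟩
    ΣF n U + t * x c      ∎
    where
    U V : Fin n → Carrier
    U e = if does (cls e ≟ ω) ∧ not (does (e ≟ c)) then x e else 0#
    V e = if does (e ≟ c) then t * x c else 0#
    V-off : ∀ e → e ≢ c → V e ≈ 0#
    V-off e e≢c = reflexive (≡.cong (λ b → if b then t * x c else 0#) (dec-false (e ≟ c) e≢c))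
    split : ∀ e → (if does (cls e ≟ ω) then weight S e else 0#) ≈ U e + V e
    split e with cls e ≟ ω | e ≟ c
    ... | yes _    | yes ≡.refl = begin
      x e * t ^ᵇ does (spans? S e) ≡⟨ ≡.cong (λ b → x e * t ^ᵇ b) (dec-true (spans? S e) spans-c) ⟩
      x e * t                      ≈⟨ *-comm _ _ ⟩
      t * x e                      ≈⟨ +-identityˡ _ ⟨
      0# + t * x e                 ∎
    ... | yes ce≡ω | no e≢c = begin
      x e * t ^ᵇ does (spans? S e) ≡⟨ ≡.cong (λ b → x e * t ^ᵇ b) (dec-false (spans? S e) (e≢c ∘ good e ce≡ω)) ⟩
      x e * 1#                     ≈⟨ *-identityʳ _ ⟩
      x e                          ≈⟨ +-identityʳ _ ⟨
      x e + 0#                     ∎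
    ... | no ce≢ω  | yes ≡.refl = ⊥-elim (ce≢ω cc≡ω)
    ... | no _     | no _       = sym (+-identityˡ 0#)

  module _ (comp? : ∀ τ → Dec (Cocompatible Z _≺_ (toSubset Z _≺_ τ)))
           (act? : ∀ τ ω → Dec (Active Z _≺_ (toSubset Z _≺_ τ) ω)) where
    open Equivalence

    rhsFactor : Choice → Fin m → Carrier
    rhsFactor τ ω = if does (act? τ ω)
      then ΣF n (λ e → if does (cls e ≟ ω) ∧ not (does (e ≟ lookup τ ω)) then x e else 0#) + t * x (lookup τ ω)
      else x (lookup τ ω)

    module _ {τ : Choice} (choice : IsChoice Z _≺_ τ) where

      settled≈rhsFactor : ∀ ω → Good ω (Above τ ω) (lookup τ ω) →
                          settled ω (Above τ ω) (lookup τ ω) ≈ rhsFactor τ ω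
      settled≈rhsFactor ω good = sym (if-dec (act? τ ω) active inactive)
        where
        τω = lookup τ ω
        active : Active Z _≺_ (toSubset Z _≺_ τ) ω → _ ≈ settled ω (Above τ ω) τω
        active act with to (active⇔live τ ω) act
        ... | live@(e , ce≡ω , spans-e) = sym (trans (settled-live good live)
          (spread-good (choice ω) good (≡.subst (Spans (Above τ ω)) (good e ce≡ω spans-e) spans-e)))
        inactive : ¬ Active Z _≺_ (toSubset Z _≺_ τ) ω → x τω ≈ settled ω (Above τ ω) τω
        inactive ¬act = sym (trans (settled-dead (¬act ∘ from (active⇔live τ ω))) (begin
          x τω * t ^ᵇ does (spans? (Above τ ω) τω)
            ≡⟨ ≡.cong (λ b → x τω * t ^ᵇ b) (dec-false (spans? (Above τ ω) τω) ¬spans) ⟩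
          x τω * 1#
            ≈⟨ *-identityʳ _ ⟩
          x τω ∎))
          where
          ¬spans : ¬ Spans (Above τ ω) τω
          ¬spans spans = ¬act (from (active⇔live τ ω) (τω , choice ω , spans))

      processed≈RHS-term : ∏ (factor (λ _ → true) τ) ≈ (if does (comp? τ) then ΠF m (rhsFactor τ) else 0#)
      processed≈RHS-term = sym (if-dec (comp? τ) cocompatible ¬cocompatible)
        where
        cocompatible : Cocompatible Z _≺_ (toSubset Z _≺_ τ) → ΠF m (rhsFactor τ) ≈ ∏ (factor (λ _ → true) τ)
        cocompatible coc = trans (reflexive (ΠF≡∏ m (rhsFactor τ)))
          (Prod.sum-cong-≋ λ ω → sym (settled≈rhsFactor ω (to (cocompatible⇔good τ) coc ω)))
        ¬cocompatible : ¬ Cocompatible Z _≺_ (toSubset Z _≺_ τ) → 0# ≈ ∏ (factor (λ _ → true) τ)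
        ¬cocompatible ¬coc
          with ¬∀⟶∃¬ m _ (λ ω → good? ω (Above τ ω) (lookup τ ω)) (¬coc ∘ from (cocompatible⇔good τ))
        ... | ω , bad = sym (∏-zero _ ω (settled-bad bad))

    processed≈RHS : total (λ _ → true) ≈ Sides.RHS R Z _≺_ x t comp? act?
    processed≈RHS = ΣL-cong (allVecs n m) λ τ → sym (if-dec (choice? τ)
      (λ choice → trans (sym (processed≈RHS-term choice)) (sym (summand-choice (λ _ → true) τ choice)))
      (λ ¬choice → sym (summand-¬choice (λ _ → true) τ ¬choice)))

  Q≈unprocessed : Sides.Q R Z _≺_ x t ≈ total (λ _ → false)
  Q≈unprocessed = ΣL-cong (allVecs n m) λ τ → if-dec (choice? τ)
    (λ choice → trans (Q-term≈unprocessed τ choice) (sym (summand-choice (λ _ → false) τ choice)))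
    (λ ¬choice → sym (summand-¬choice (λ _ → false) τ ¬choice))

theorem4p11 : ∀ {c ℓ} (R : CommutativeSemiring c ℓ) {n m : ℕ} (Z : Multimatroid n m)
    (_≺_ : Rel (Fin m) 0ℓ) → IsStrictTotalOrder _≡_ _≺_ →
    (x : Fin n → CommutativeSemiring.Carrier R) (t : CommutativeSemiring.Carrier R) →
    (comp? : ∀ τ → Dec (Cocompatible Z _≺_ (toSubset Z _≺_ τ))) →
    (act? : ∀ τ ω → Dec (Active Z _≺_ (toSubset Z _≺_ τ) ω)) →
    CommutativeSemiring._≈_ R (Sides.Q R Z _≺_ x t) (Sides.RHS R Z _≺_ x t comp? act?)
theorem4p11 R Z _≺_ sto x t comp? act? = begin
  Sides.Q R Z _≺_ x t               ≈⟨ Q≈unprocessed ⟩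
  total (λ _ → false)               ≈⟨ unprocessed≈processed ⟩
  total (λ _ → true)                ≈⟨ processed≈RHS comp? act? ⟩
  Sides.RHS R Z _≺_ x t comp? act?  ∎
  where
  open Expansion R Z _≺_ sto x t
  open import Relation.Binary.Reasoning.Setoid (CommutativeSemiring.setoid R)
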